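{- A classical nonnesting partition $\pi$ for $D_n$ is uniquely determined by the values of $a(\pi)$, $\mu(\pi)$, $\nu(\pi)$, and $c(\pi)$.
   Context: Let $W=D_n$ with its standard coordinates in $\mathbb R^n$ (simple roots $e_1+e_2, e_2-e_1, e_3-e_2,\dots,e_n-e_{n-1}$), writing $\pm i$ for $\pm e_i$. A classical partition for $D_n$ is a partition $\mathrm{Part}(L)$ of $\{\pm 1,\dots,\pm n\}\cup\{0\}$ whose parts are the intersections of this set with the fibers of the projection onto some intersection $L$ of reflecting hyperplanes (of the form $x_i=\pm x_j$); it is symmetric under negation, and the block containing $0$ (called the zero block if it contains other elements) is the only block fixed by negation. For a partition $P$ of an ordered ground set, let $G(P)$ be the graph whose edges are the pairs $(s,s')$ with $s<s'$ in the same block and no element of that block strictly between them. $P$ is nonnesting if $G(P)$ has no two edges $(a,d),(b,c)$ with $a<b<c<d$. A classical nonnesting partition for $D_n$ is a classical partition for $D_n$ that is nonnesting with respect to the strict weak order $-n<\cdots<-2<-1,\ 1<2<\cdots<n$ in which $1$ and $-1$ are incomparable (so edges ending at $1$ and at $-1$ are never considered to nest). Statistics: in type $D$ the elements $\pm1$ are regarded as neither positive nor negative. A switching block contains both positive and nonpositive elements; a nonswitching block contains only positive or only nonpositive elements. On blocks containing positive elements, $B<_{\rm lp}B'$ iff the least positive element of $B$ is less than that of $B'$. Let $M_1<_{\rm lp}\cdots<_{\rm lp}M_m$ be the positive nonswitching blocks of $\pi$, $a_i$ the least element of $M_i$, $\mu_i=|M_i|$; let $P_1<_{\rm lp}\cdots<_{\rm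 lp}P_k$ be the switching blocks and $\nu_i$ the number of positive elements of $P_i$. Put $a(\pi)=(a_1,\dots,a_m)$, $\mu(\pi)=(\mu_1,\dots,\mu_m)$, $\nu(\pi)=(\nu_1,\dots,\nu_k)$. Let $R_1<_{\rm lp}\cdots<_{\rm lp}R_l$ be the blocks of $\pi$ containing both a positive element and $1$ or $-1$ (so $l\le 2$), and $c(\pi)=(c_1,\dots,c_l)$ with $c_i=R_i\cap\{1,-1\}$ (written as $+$, $-$, or $\pm$). -}

module Defs where

open import Data.Nat as ℕ using (ℕ; zero; suc; _∸_)
open import Data.Nat.Properties using (_<?_)
open import Data.Integer as ℤ using (ℤ; +_; -[1+_]; -_; _≤ᵇ_)
open import Data.Fin using (Fin; fromℕ<)
open import Data.Bool using (Bool; true; false; if_then_else_; not; _∧_; _∨_)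
open import Data.List using (List; []; _∷_; map; upTo; concatMap; filterᵇ; length)
open import Data.Bool.ListAction using (all; any)
open import Data.List.Relation.Unary.All using (All)
open import Data.Product using (_×_; _,_)
open import Data.Empty using (⊥)
open import Relation.Nullary using (yes; no; ¬_)
open import Relation.Binary.PropositionalEquality using (_≡_; _≢_)

-- Ground set {±1,…,±n} ∪ {0}, encoded as integers: +k is e_k, -k is -e_k,
-- 0 is the origin.

InGround : ℕ → ℤ → Set
InGround n z = ℤ.∣ z ∣ ℕ.≤ n

ground : ℕ → List ℤ
ground n = + 0 ∷ concatMap (λ k → + suc k ∷ -[1+ k ] ∷ []) (upTo n)

-- Points of ℤ^n (coordinates indexed by Fin n; coordinate  k  of Fin n
-- is the paper's coordinate k+1) and the linear functional "pair with s".

coord : ∀ {n} → (Fin n → ℤ) → ℕ → ℤ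
coord {n} x k with k <? n
... | yes p = x (fromℕ< p)
... | no _  = + 0

ev : ∀ {n} → (Fin n → ℤ) → ℤ → ℤ
ev x (+ zero)    = + 0
ev x (+ suc k)   = coord x k
ev x -[1+ k ]    = - coord x k

-- Reflecting hyperplanes of D_n:  x_i = x_j  (same = true)  or
-- x_i = - x_j  (same = false), with i ≠ j.

record DHyperplane (n : ℕ) : Set where
  constructor hyp
  field
    i j      : Fin n
    distinct : i ≢ j
    same     : Bool

OnHyperplane : ∀ {n} → DHyperplane n → (Fin n → ℤ) → Set
OnHyperplane h x = x (DHyperplane.i h)
  ≡ (if DHyperplane.same h then x (DHyperplane.j h) else - x (DHyperplane.j h))

InFlat : ∀ {n} → List (DHyperplane n) → (Fin n → ℤ) → Set
InFlat hs x = All (λ h → OnHyperplane h x) hs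

-- s and t lie in the same fiber of the orthogonal projection onto L:
-- s - t ⊥ L, i.e. ⟨s,x⟩ = ⟨t,x⟩ for every (lattice) point x of L.
SameFiber : ∀ {n} → List (DHyperplane n) → ℤ → ℤ → Set
SameFiber hs s t = ∀ x → InFlat hs x → ev x s ≡ ev x t

IsPart : (n : ℕ) → List (DHyperplane n) → (ℤ → ℤ → Bool) → Set
IsPart n hs R = ∀ s t → InGround n s → InGround n t →
  (R s t ≡ true → SameFiber hs s t) × (SameFiber hs s t → R s t ≡ true)

-- The strict weak order  -n < … < -2 < {-1 , 1} < 2 < … < n  on the
-- nonzero elements (0 is not compared with anything).

level : ℤ → ℤ
level (+ suc zero) = + 0
level -[1+ zero ]  = + 0
level z            = z

_≺_ : ℤ → ℤ → Set
s ≺ t = (s ≢ + 0) × (t ≢ + 0) × (level s ℤ.< level t)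

Edge : ℕ → (ℤ → ℤ → Bool) → ℤ → ℤ → Set
Edge n R s t = InGround n s × InGround n t × R s t ≡ true × s ≺ t ×
  (∀ u → InGround n u → R s u ≡ true → ¬ (s ≺ u × u ≺ t))

NonNesting : ℕ → (ℤ → ℤ → Bool) → Set
NonNesting n R = ∀ a b c d → Edge n R a d → Edge n R b c →
  a ≺ b → b ≺ c → c ≺ d → ⊥

-- Statistics.  Positive elements: 2, …, n  (±1 are neither positive nor
-- negative).

isPos : ℤ → Bool
isPos (+ suc (suc _)) = true
isPos _               = false

positives : ℕ → List ℤ
positives n = map (λ k → + suc (suc k)) (upTo (n ∸ 1))

block : ℕ → (ℤ → ℤ → Bool) → ℤ → List ℤ
block n R s = filterᵇ (R s) (ground n)

isLeastPos : ℕ → (ℤ → ℤ → Bool) → ℤ → Bool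
isLeastPos n R p = not (any (λ q → not (p ≤ᵇ q) ∧ R p q) (positives n))

-- least (positive) elements of the positive nonswitching blocks, in
-- increasing order, i.e. the blocks M_1 <lp … <lp M_m
nonswitchLeasts : ℕ → (ℤ → ℤ → Bool) → List ℤ
nonswitchLeasts n R =
  filterᵇ (λ p → isLeastPos n R p ∧ all isPos (block n R p)) (positives n)

-- least positive elements of the switching blocks P_1 <lp … <lp P_k
switchLeasts : ℕ → (ℤ → ℤ → Bool) → List ℤ
switchLeasts n R =
  filterᵇ (λ p → isLeastPos n R p ∧ not (all isPos (block n R p))) (positives n)

oneLeasts : ℕ → (ℤ → ℤ → Bool) → List ℤ
oneLeasts n R =
  filterᵇ (λ p → isLeastPos n R p ∧ (R p (+ 1) ∨ R p -[1+ 0 ])) (positives n)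

aStat : ℕ → (ℤ → ℤ → Bool) → List ℤ
aStat n R = nonswitchLeasts n R

μStat : ℕ → (ℤ → ℤ → Bool) → List ℕ
μStat n R = map (λ p → length (block n R p)) (nonswitchLeasts n R)

νStat : ℕ → (ℤ → ℤ → Bool) → List ℕ
νStat n R = map (λ p → length (filterᵇ isPos (block n R p))) (switchLeasts n R)

-- c_i = R_i ∩ {1,-1}, encoded as (1 ∈ R_i , -1 ∈ R_i)
cStat : ℕ → (ℤ → ℤ → Bool) → List (Bool × Bool)
cStat n R = map (λ p → (R p (+ 1) , R p -[1+ 0 ])) (oneLeasts n R)

-- Positive elements are reconstructed in increasing order. Suppose two partitions
-- with the same statistics first differ at p. Either p opens a block in just one of
-- them, which changes the number of switching blocks, or p is attached to an earlier
-- element q in one and to some q′ > q in the other; then the block of q loses p in the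
-- second partition, and nonnesting keeps it from gaining any later element instead,
-- so its size, recorded in μ or ν, changes. Next, the blocks meeting ±1 are located
-- by their number and their traces on ±1 read off from c. Every other switching block
-- is paired with the negative of a block; nonnesting makes this pairing
-- order-reversing on least elements, which determines it. Finally 0 lies in the block
-- of x exactly when x and -x share a block.

module Submission where

open import Defs
open import Data.Nat as ℕ using (ℕ; zero; suc; z≤n; s≤s; _<_; _≤_; _∸_; _+_)
import Data.Nat.Properties as ℕP
open import Data.Integer as ℤ using (ℤ; +_; -[1+_]; -_)
import Data.Integer.Properties as ℤP
open import Data.Integer.Properties using (neg-involutive; ∣-i∣≡∣i∣)
open import Data.Fin as Fin using (Fin; fromℕ<; toℕ)
open import Data.Fin.Properties using (fromℕ<-toℕ; toℕ<n)
open import Data.Bool using (Bool; true; false; _∧_; _∨_; not; T)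
open import Data.Bool.Properties using (∧-zeroʳ; ⇔→≡)
open import Data.Bool.ListAction using (all; any)
open import Data.List using (List; []; _∷_; map; filterᵇ; length; applyUpTo; upTo; concatMap)
open import Data.List.Properties using (map-upTo; length-map; ∷-injectiveˡ; ∷-injectiveʳ)
open import Data.List.Membership.Propositional using (_∈_; find)
open import Data.List.Membership.Propositional.Properties
  using (∈-applyUpTo⁺; ∈-applyUpTo⁻; ∈-upTo⁺; ∈-upTo⁻; ∈-concatMap⁺; ∈-concatMap⁻)
open import Data.List.Relation.Unary.Any as Any using (here; there)
open import Data.List.Relation.Unary.All as All using (All; []; _∷_)
open import Data.List.Relation.Unary.All.Properties using (applyUpTo⁺₁)
open import Data.Product using (_×_; _,_; proj₁; proj₂; ∃-syntax)
open import Data.Sum using (_⊎_; inj₁; inj₂)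
open import Data.Empty using (⊥; ⊥-elim)
open import Function using (_∘_)
open import Function.Bundles using (mk⇔)
open import Relation.Nullary using (yes; no)
open import Relation.Binary.PropositionalEquality
open import Relation.Binary.Definitions using (tri<; tri≈; tri>)

true≢false : true ≢ false
true≢false ()

false≢true : false ≢ true
false≢true ()

≡-from-≡true : ∀ {a b : Bool} → (a ≡ true → b ≡ true) → (b ≡ true → a ≡ true) → a ≡ b
≡-from-≡true f g = ⇔→≡ (mk⇔ f g)

not-true : ∀ {b} → not b ≡ true → b ≡ false
not-true {false} _ = refl

not-false : ∀ {b} → b ≡ false → not b ≡ true
not-false refl = refl

∧-true : ∀ {a b} → a ≡ true → b ≡ true → a ∧ b ≡ true
∧-true refl e = e

∧-trueˡ : ∀ {a b} → a ∧ b ≡ true → a ≡ true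
∧-trueˡ {true} _ = refl

∧-trueʳ : ∀ {a b} → a ∧ b ≡ true → b ≡ true
∧-trueʳ {true} e = e

∧-false : ∀ {a b} → a ≡ true → a ∧ b ≡ false → b ≡ false
∧-false refl e = e

∧-not-true : ∀ {a b} → a ≡ true → a ∧ b ≡ false → a ∧ not b ≡ true
∧-not-true {b = false} refl _ = refl

∧-not-cong : ∀ {a a′ b b′} → a ≡ a′ → a ∧ b ≡ a′ ∧ b′ → a ∧ not b ≡ a′ ∧ not b′
∧-not-cong {false} refl _ = refl
∧-not-cong {true}  refl e = cong not e

∨-true : ∀ {a b} → a ∨ b ≡ true → a ≡ true ⊎ b ≡ true
∨-true {true}  _ = inj₁ refl
∨-true {false} e = inj₂ e

∨-trueˡ : ∀ {a b} → a ≡ true → a ∨ b ≡ true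
∨-trueˡ refl = refl

∨-trueʳ : ∀ {a b} → b ≡ true → a ∨ b ≡ true
∨-trueʳ {true}  _ = refl
∨-trueʳ {false} e = e

∨-falseˡ : ∀ {a b} → a ∨ b ≡ false → a ≡ false
∨-falseˡ {false} _ = refl

∨-falseʳ : ∀ {a b} → a ∨ b ≡ false → b ≡ false
∨-falseʳ {false} e = e

module _ {A : Set} where

  countᵇ : (A → Bool) → List A → ℕ
  countᵇ P xs = length (filterᵇ P xs)

  countᵇ-mono : ∀ (P Q : A → Bool) xs → All (λ x → Q x ≡ true → P x ≡ true) xs →
    countᵇ Q xs ≤ countᵇ P xs
  countᵇ-mono P Q [] [] = z≤n
  countᵇ-mono P Q (x ∷ xs) (Q⇒P ∷ H) with Q x | P x
  ... | true  | true  = s≤s (countᵇ-mono P Q xs H)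
  ... | true  | false = ⊥-elim (false≢true (Q⇒P refl))
  ... | false | true  = ℕP.m≤n⇒m≤1+n (countᵇ-mono P Q xs H)
  ... | false | false = countᵇ-mono P Q xs H

  countᵇ-< : ∀ (P Q : A → Bool) xs → All (λ x → Q x ≡ true → P x ≡ true) xs →
    ∀ {y} → y ∈ xs → Q y ≡ false → P y ≡ true → countᵇ Q xs < countᵇ P xs
  countᵇ-< P Q (x ∷ xs) (_ ∷ H) (here refl) qf pt rewrite qf | pt = s≤s (countᵇ-mono P Q xs H)
  countᵇ-< P Q (x ∷ xs) (Q⇒P ∷ H) (there y∈) qf pt with Q x | P x
  ... | true  | true  = s≤s (countᵇ-< P Q xs H y∈ qf pt)
  ... | true  | false = ⊥-elim (false≢true (Q⇒P refl))
  ... | false | true  = ℕP.m≤n⇒m≤1+n (countᵇ-< P Q xs H y∈ qf pt)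
  ... | false | false = countᵇ-< P Q xs H y∈ qf pt

  map-filterᵇ-≡⇒countᵇ-≡ : ∀ {B : Set} (f g : A → B) (P Q : A → Bool) xs →
    map f (filterᵇ P xs) ≡ map g (filterᵇ Q xs) → countᵇ P xs ≡ countᵇ Q xs
  map-filterᵇ-≡⇒countᵇ-≡ f g P Q xs E =
    trans (sym (length-map f (filterᵇ P xs))) (trans (cong length E) (length-map g (filterᵇ Q xs)))

  filterᵇ-comm : ∀ (P Q : A → Bool) xs → filterᵇ P (filterᵇ Q xs) ≡ filterᵇ Q (filterᵇ P xs)
  filterᵇ-comm P Q [] = refl
  filterᵇ-comm P Q (x ∷ xs) with Q x in eq | P x in ep
  ... | true  | true  rewrite eq | ep = cong (x ∷_) (filterᵇ-comm P Q xs)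
  ... | true  | false rewrite ep = filterᵇ-comm P Q xs
  ... | false | true  rewrite eq = filterᵇ-comm P Q xs
  ... | false | false = filterᵇ-comm P Q xs

  filterᵇ-all : ∀ (P : A → Bool) xs → all P xs ≡ true → filterᵇ P xs ≡ xs
  filterᵇ-all P [] _ = refl
  filterᵇ-all P (x ∷ xs) E with P x
  ... | true = cong (x ∷_) (filterᵇ-all P xs E)

  all-filterᵇ-true : ∀ (P Q : A → Bool) xs → all P (filterᵇ Q xs) ≡ true →
    ∀ {x} → x ∈ xs → Q x ≡ true → P x ≡ true
  all-filterᵇ-true P Q (y ∷ xs) E (here refl) qx rewrite qx with P y
  ... | true = refl
  all-filterᵇ-true P Q (y ∷ xs) E (there x∈) qx with Q y
  ... | false = all-filterᵇ-true P Q xs E x∈ qx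
  ... | true with P y
  ...   | true = all-filterᵇ-true P Q xs E x∈ qx

  all-filterᵇ-false : ∀ (P Q : A → Bool) xs → all P (filterᵇ Q xs) ≡ false →
    ∃[ x ] x ∈ xs × Q x ≡ true × P x ≡ false
  all-filterᵇ-false P Q (x ∷ xs) E with Q x in eq
  ... | false with all-filterᵇ-false P Q xs E
  ...   | y , y∈ , qy , py = y , there y∈ , qy , py
  all-filterᵇ-false P Q (x ∷ xs) E | true with P x in ep
  ...   | false = x , here refl , eq , ep
  ...   | true with all-filterᵇ-false P Q xs E
  ...     | y , y∈ , qy , py = y , there y∈ , qy , py

  any-false : ∀ (P : A → Bool) xs → All (λ x → P x ≡ false) xs → any P xs ≡ false
  any-false P [] [] = refl
  any-false P (x ∷ xs) (px ∷ H) rewrite px = any-false P xs H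

  any-false⁻ : ∀ (P : A → Bool) xs → any P xs ≡ false → ∀ {x} → x ∈ xs → P x ≡ false
  any-false⁻ P (y ∷ xs) E (here refl) with P y
  ... | false = refl
  any-false⁻ P (y ∷ xs) E (there x∈) with P y
  ... | false = any-false⁻ P xs E x∈

  head-filterᵇ-∈ : ∀ (Q : A → Bool) xs {y ys} → filterᵇ Q xs ≡ y ∷ ys → y ∈ xs
  head-filterᵇ-∈ Q (x ∷ xs) E with Q x
  ... | true  = here (sym (∷-injectiveˡ E))
  ... | false = there (head-filterᵇ-∈ Q xs E)

  filterᵇ-≡⇒pointwise : ∀ (P Q : A → Bool) (h : ℕ → A) → (∀ {i j} → h i ≡ h j → i ≡ j) → ∀ m →
    filterᵇ P (applyUpTo h m) ≡ filterᵇ Q (applyUpTo h m) → ∀ {k} → k < m → P (h k) ≡ Q (h k)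
  filterᵇ-≡⇒pointwise P Q h inj (suc m) = pointwise
    where
    fresh : h 0 ∈ applyUpTo (h ∘ suc) m → ⊥
    fresh h0∈ with ∈-applyUpTo⁻ (h ∘ suc) h0∈
    ... | j , _ , e with inj e
    ...   | ()
    from-head : P (h 0) ≡ Q (h 0) →
      filterᵇ P (applyUpTo (h ∘ suc) m) ≡ filterᵇ Q (applyUpTo (h ∘ suc) m) →
      ∀ {k} → k < suc m → P (h k) ≡ Q (h k)
    from-head e _ {zero}  _         = e
    from-head _ E {suc k} (s≤s k<m) = filterᵇ-≡⇒pointwise P Q (h ∘ suc) (ℕP.suc-injective ∘ inj) m E k<m
    pointwise : filterᵇ P (applyUpTo h (suc m)) ≡ filterᵇ Q (applyUpTo h (suc m)) →
      ∀ {k} → k < suc m → P (h k) ≡ Q (h k)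
    pointwise E with P (h 0) in ep | Q (h 0) in eq
    ... | true  | false = ⊥-elim (fresh (head-filterᵇ-∈ Q _ (sym E)))
    ... | false | true  = ⊥-elim (fresh (head-filterᵇ-∈ P _ E))
    ... | true  | true  = from-head (trans ep (sym eq)) (∷-injectiveʳ E)
    ... | false | false = from-head (trans ep (sym eq)) E

  map-filterᵇ-≡-at : ∀ {B : Set} (f g : A → B) (P Q : A → Bool) (h : ℕ → A) m →
    map f (filterᵇ P (applyUpTo h m)) ≡ map g (filterᵇ Q (applyUpTo h m)) →
    ∀ {k} → k < m → (∀ {i} → i < k → P (h i) ≡ Q (h i)) → P (h k) ≡ true → Q (h k) ≡ true →
    f (h k) ≡ g (h k)
  map-filterᵇ-≡-at f g P Q h (suc m) E {zero} _ _ pt qt rewrite pt | qt = ∷-injectiveˡ E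
  map-filterᵇ-≡-at f g P Q h (suc m) E {suc k} (s≤s k<m) agree pt qt with P (h 0) in ep | Q (h 0) in eq
  ... | true  | true  = map-filterᵇ-≡-at f g P Q (h ∘ suc) m (∷-injectiveʳ E) k<m (agree ∘ s≤s) pt qt
  ... | false | false = map-filterᵇ-≡-at f g P Q (h ∘ suc) m E k<m (agree ∘ s≤s) pt qt
  ... | true  | false = ⊥-elim (true≢false (trans (sym ep) (trans (agree (s≤s z≤n)) eq)))
  ... | false | true  = ⊥-elim (false≢true (trans (sym ep) (trans (agree (s≤s z≤n)) eq)))

least : (P : ℕ → Bool) (m : ℕ) →
  (∃[ i ] i < m × P i ≡ true × (∀ {j} → j < i → P j ≡ false)) ⊎ (∀ {i} → i < m → P i ≡ false)
least P zero = inj₂ λ ()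
least P (suc m) with least P m
... | inj₁ (i , i<m , pi , H) = inj₁ (i , ℕP.m≤n⇒m≤1+n i<m , pi , H)
... | inj₂ H with P m in pm
...   | true  = inj₁ (m , ℕP.n<1+n m , pm , H)
...   | false = inj₂ below
  where
  below : ∀ {i} → i < suc m → P i ≡ false
  below (s≤s i≤m) with ℕP.m≤n⇒m<n∨m≡n i≤m
  ... | inj₁ i<m  = H i<m
  ... | inj₂ refl = pm

greatest : (P : ℕ → Bool) (m : ℕ) →
  (∃[ i ] i < m × P i ≡ true × (∀ {j} → i < j → j < m → P j ≡ false)) ⊎ (∀ {i} → i < m → P i ≡ false)
greatest P zero = inj₂ λ ()
greatest P (suc m) with P m in pm
... | true = inj₁ (m , ℕP.n<1+n m , pm , λ m<j j<1+m → ⊥-elim (ℕP.<-irrefl refl (ℕP.<-≤-trans m<j (ℕP.≤-pred j<1+m))))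
... | false with greatest P m
...   | inj₁ (i , i<m , pi , H) = inj₁ (i , ℕP.m≤n⇒m≤1+n i<m , pi , above)
  where
  above : ∀ {j} → i < j → j < suc m → P j ≡ false
  above i<j (s≤s j≤m) with ℕP.m≤n⇒m<n∨m≡n j≤m
  ... | inj₁ j<m  = H i<j j<m
  ... | inj₂ refl = pm
...   | inj₂ H = inj₂ below
  where
  below : ∀ {i} → i < suc m → P i ≡ false
  below (s≤s i≤m) with ℕP.m≤n⇒m<n∨m≡n i≤m
  ... | inj₁ i<m  = H i<m
  ... | inj₂ refl = pm

-- pos k and neg k are ±(k + 2): the positive elements of D_n are the pos k with k + 2 ≤ n.
pos neg : ℕ → ℤ
pos k = + suc (suc k)
neg k = -[1+ suc k ]

pos-injective : ∀ {k l} → pos k ≡ pos l → k ≡ l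
pos-injective refl = refl

InRange : ℕ → ℕ → Set
InRange n k = suc (suc k) ≤ n

InRange-≤ : ∀ {n k l} → k ≤ l → InRange n l → InRange n k
InRange-≤ k≤l = ℕP.≤-trans (s≤s (s≤s k≤l))

InRange-< : ∀ {n k l} → k < l → InRange n l → InRange n k
InRange-< k<l = InRange-≤ (ℕP.<⇒≤ k<l)

InGround-neg : ∀ {n} s → InGround n s → InGround n (- s)
InGround-neg {n} s = subst (_≤ n) (sym (∣-i∣≡∣i∣ s))

pos≺pos : ∀ {k l} → k < l → pos k ≺ pos l
pos≺pos k<l = (λ ()) , (λ ()) , ℤ.+<+ (s≤s (s≤s k<l))

neg≺pos : ∀ {k l} → neg k ≺ pos l
neg≺pos = (λ ()) , (λ ()) , ℤ.-<+

neg≺neg : ∀ {k l} → k < l → neg l ≺ neg k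
neg≺neg k<l = (λ ()) , (λ ()) , ℤ.-<- (s≤s k<l)

one≺pos : ∀ {l} → (+ 1) ≺ pos l
one≺pos = (λ ()) , (λ ()) , ℤ.+<+ (s≤s z≤n)

minus-one≺pos : ∀ {l} → -[1+ 0 ] ≺ pos l
minus-one≺pos = (λ ()) , (λ ()) , ℤ.+<+ (s≤s z≤n)

neg≺one : ∀ {k} → neg k ≺ (+ 1)
neg≺one = (λ ()) , (λ ()) , ℤ.-<+

neg≺minus-one : ∀ {k} → neg k ≺ -[1+ 0 ]
neg≺minus-one = (λ ()) , (λ ()) , ℤ.-<+

data Below (p : ℕ) : ℤ → Set where
  one       : Below p (+ 1)
  minus-one : Below p -[1+ 0 ]
  positive  : ∀ {l} → l < p → Below p (pos l)
  negative  : ∀ l → Below p (neg l)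

below : ∀ {p} u → u ≺ pos p → Below p u
below (+ zero)        (u≢0 , _ , _)                    = ⊥-elim (u≢0 refl)
below (+ suc zero)    _                                = one
below (+ suc (suc l)) (_ , _ , ℤ.+<+ (s≤s (s≤s l<p))) = positive l<p
below -[1+ zero ]     _                                = minus-one
below -[1+ suc l ]    _                                = negative l

pos≺pos⇒pos : ∀ {p q} u → pos q ≺ u → u ≺ pos p → ∃[ l ] u ≡ pos l × q < l × l < p
pos≺pos⇒pos u q≺u u≺p with below u u≺p | q≺u
... | positive l<p   | (_ , _ , ℤ.+<+ (s≤s (s≤s q<l))) = _ , refl , q<l , l<p
... | one       | (_ , _ , ℤ.+<+ ())
... | minus-one | (_ , _ , ℤ.+<+ ())
... | negative _     | (_ , _ , ())

unit≺pos⇒pos : ∀ {x p} u → level x ≡ + 0 → x ≺ u → u ≺ pos p → ∃[ l ] u ≡ pos l × l < p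
unit≺pos⇒pos u lx (_ , _ , x<u) u≺p with below u u≺p
... | positive l<p   = _ , refl , l<p
... | one       = ⊥-elim (ℤP.<-irrefl refl (subst (ℤ._< + 0) lx x<u))
... | minus-one = ⊥-elim (ℤP.<-irrefl refl (subst (ℤ._< + 0) lx x<u))
... | negative l     with subst (ℤ._< neg l) lx x<u
...   | ()

neg≺neg⇒< : ∀ {v l} → neg v ≺ neg l → l < v
neg≺neg⇒< (_ , _ , ℤ.-<- (s≤s l<v)) = l<v

-- Classical nonnesting partitions

record NonnestingPartition (n : ℕ) (R : ℤ → ℤ → Bool) : Set where
  field
    reflexive  : ∀ {s} → InGround n s → R s s ≡ true
    symmetric  : ∀ {s t} → InGround n s → InGround n t → R s t ≡ true → R t s ≡ true
    transitive : ∀ {s t u} → InGround n s → InGround n t → InGround n u →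
                 R s t ≡ true → R t u ≡ true → R s u ≡ true
    neg-closed : ∀ {s t} → InGround n s → InGround n t → R s t ≡ true → R (- s) (- t) ≡ true
    zero-block : ∀ {s} → InGround n s → R s (- s) ≡ true → R (+ 0) s ≡ true
    -- ±1 never form the zero block on their own: x₁ = 0 on a flat of D_n only through
    -- a hyperplane x₁ = ±x_j, which forces x_j = 0 as well.
    zero∼one⇒zero∼pos : R (+ 0) (+ 1) ≡ true → ∃[ k ] InRange n k × R (+ 0) (pos k) ≡ true
    nonnesting : NonNesting n R

ev-neg : ∀ {n} (x : Fin n → ℤ) s → ev x (- s) ≡ - ev x s
ev-neg x (+ zero)  = refl
ev-neg x (+ suc k) = refl
ev-neg x -[1+ k ]  = sym (neg-involutive _)

≡-neg⇒≡0 : ∀ (a : ℤ) → a ≡ - a → a ≡ + 0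
≡-neg⇒≡0 (+ zero) _ = refl

coord-< : ∀ {n} (x : Fin n → ℤ) {k} (k<n : k < n) → coord x k ≡ x (fromℕ< k<n)
coord-< {n} x {k} k<n with k ℕP.<? n
... | yes _   = refl
... | no k≮n = ⊥-elim (k≮n k<n)

e₁ : ∀ {m} → Fin (suc m) → ℤ
e₁ Fin.zero    = + 1
e₁ (Fin.suc _) = + 0

Touches₁ : ∀ {m} → DHyperplane (suc m) → Set
Touches₁ h = DHyperplane.i h ≡ Fin.zero ⊎ DHyperplane.j h ≡ Fin.zero

e₁∈flat⊎touches₁ : ∀ {m} (hs : List (DHyperplane (suc m))) →
  InFlat hs e₁ ⊎ ∃[ h ] h ∈ hs × Touches₁ h
e₁∈flat⊎touches₁ [] = inj₁ []
e₁∈flat⊎touches₁ (hyp Fin.zero j _ _ ∷ _)             = inj₂ (_ , here refl , inj₁ refl)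
e₁∈flat⊎touches₁ (hyp (Fin.suc i) Fin.zero _ _ ∷ _)   = inj₂ (_ , here refl , inj₂ refl)
e₁∈flat⊎touches₁ (hyp (Fin.suc i) (Fin.suc j) i≢j s ∷ hs) with e₁∈flat⊎touches₁ hs
... | inj₁ e₁∈ = inj₁ (on-h s ∷ e₁∈)
  where
  on-h : ∀ s → OnHyperplane (hyp (Fin.suc i) (Fin.suc j) i≢j s) e₁
  on-h true  = refl
  on-h false = refl
... | inj₂ (h , h∈ , t) = inj₂ (h , there h∈ , t)

touches₁⇒partner : ∀ {m} (h : DHyperplane (suc m)) → Touches₁ h →
  ∃[ j ] ∀ x → OnHyperplane h x → x Fin.zero ≡ + 0 → x (Fin.suc j) ≡ + 0
touches₁⇒partner (hyp Fin.zero Fin.zero i≢j _) _ = ⊥-elim (i≢j refl)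
touches₁⇒partner (hyp Fin.zero (Fin.suc j) _ true)  _ = j , λ x on x₀ → trans (sym on) x₀
touches₁⇒partner (hyp Fin.zero (Fin.suc j) _ false) _ =
  j , λ x on x₀ → trans (sym (neg-involutive _)) (cong -_ (trans (sym on) x₀))
touches₁⇒partner (hyp (Fin.suc i) Fin.zero _ true)  _ = i , λ x on x₀ → trans on x₀
touches₁⇒partner (hyp (Fin.suc i) Fin.zero _ false) _ = i , λ x on x₀ → trans on (cong -_ x₀)
touches₁⇒partner (hyp (Fin.suc _) (Fin.suc _) _ _) (inj₁ ())
touches₁⇒partner (hyp (Fin.suc _) (Fin.suc _) _ _) (inj₂ ())

module _ {n : ℕ} {hs : List (DHyperplane n)} {R : ℤ → ℤ → Bool} (part : IsPart n hs R) where

  private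
    fiber : ∀ {s t} → InGround n s → InGround n t → R s t ≡ true → SameFiber hs s t
    fiber gs gt = proj₁ (part _ _ gs gt)

    same-block : ∀ {s t} → InGround n s → InGround n t → SameFiber hs s t → R s t ≡ true
    same-block gs gt = proj₂ (part _ _ gs gt)

  isPart⇒zero∼one⇒zero∼pos : 2 ≤ n → R (+ 0) (+ 1) ≡ true → ∃[ k ] InRange n k × R (+ 0) (pos k) ≡ true
  isPart⇒zero∼one⇒zero∼pos (s≤s (s≤s _)) 0∼1 with e₁∈flat⊎touches₁ hs
  ... | inj₁ e₁∈ with fiber z≤n (s≤s z≤n) 0∼1 e₁ e₁∈
  ...   | ()
  isPart⇒zero∼one⇒zero∼pos (s≤s (s≤s _)) 0∼1 | inj₂ (h , h∈ , t) with touches₁⇒partner h t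
  ... | j , partner = toℕ j , s≤s (toℕ<n j) , same-block z≤n (s≤s (toℕ<n j)) same
    where
    same : SameFiber hs (+ 0) (pos (toℕ j))
    same x x∈ = sym (begin
      coord x (suc (toℕ j))       ≡⟨ coord-< x (s≤s (toℕ<n j)) ⟩
      x (fromℕ< (s≤s (toℕ<n j))) ≡⟨ cong x (fromℕ<-toℕ (Fin.suc j) (s≤s (toℕ<n j))) ⟩
      x (Fin.suc j)               ≡⟨ partner x (All.lookup x∈ h∈) x₀ ⟩
      + 0                         ∎)
      where
      open ≡-Reasoning
      x₀ : x Fin.zero ≡ + 0
      x₀ = sym (trans (fiber z≤n (s≤s z≤n) 0∼1 x x∈) (coord-< x (s≤s z≤n)))

  isPart⇒nonnestingPartition : 2 ≤ n → NonNesting n R → NonnestingPartition n R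
  isPart⇒nonnestingPartition two nn = record
    { reflexive  = λ gs → same-block gs gs λ _ _ → refl
    ; symmetric  = λ gs gt s∼t → same-block gt gs λ x x∈ → sym (fiber gs gt s∼t x x∈)
    ; transitive = λ gs gt gu s∼t t∼u → same-block gs gu λ x x∈ →
                     trans (fiber gs gt s∼t x x∈) (fiber gt gu t∼u x x∈)
    ; neg-closed = λ {s} {t} gs gt s∼t → same-block (InGround-neg s gs) (InGround-neg t gt) λ x x∈ →
                     trans (ev-neg x s) (trans (cong -_ (fiber gs gt s∼t x x∈)) (sym (ev-neg x t)))
    ; zero-block = λ {s} gs s∼-s → same-block z≤n gs λ x x∈ →
                     sym (≡-neg⇒≡0 (ev x s) (trans (fiber gs (InGround-neg s gs) s∼-s x x∈) (ev-neg x s)))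
    ; zero∼one⇒zero∼pos = isPart⇒zero∼one⇒zero∼pos two
    ; nonnesting = nn
    }

T⇒≡true : ∀ {b} → T b → b ≡ true
T⇒≡true {true} _ = refl

pos≤ᵇpos : ∀ {k l} → k ≤ l → (pos k ℤ.≤ᵇ pos l) ≡ true
pos≤ᵇpos k≤l = T⇒≡true (ℕP.≤⇒≤ᵇ (s≤s (s≤s k≤l)))

pos≰ᵇpos : ∀ {k l} → l < k → (pos k ℤ.≤ᵇ pos l) ≡ false
pos≰ᵇpos {k} {l} l<k with pos k ℤ.≤ᵇ pos l in e
... | false = refl
... | true  = ⊥-elim (ℕP.<⇒≱ l<k (ℕP.≤-pred (ℕP.≤-pred (ℕP.≤ᵇ⇒≤ (2 + k) (2 + l) (subst T (sym e) _)))))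

InRange⇒< : ∀ {n k} → InRange n k → k < n ∸ 1
InRange⇒< {suc n} (s≤s k<n) = k<n

<⇒InRange : ∀ {n k} → k < n ∸ 1 → InRange n k
<⇒InRange {suc n} k<n = s≤s k<n

signedPair : ℕ → List ℤ
signedPair k = + suc k ∷ -[1+ k ] ∷ []

∈-ground⁺ : ∀ {n} x → InGround n x → x ∈ ground n
∈-ground⁺ (+ zero)  _   = here refl
∈-ground⁺ (+ suc k) k<n = there (∈-concatMap⁺ signedPair (Any.map (λ { refl → here refl }) (∈-upTo⁺ k<n)))
∈-ground⁺ -[1+ k ]  k<n = there (∈-concatMap⁺ signedPair (Any.map (λ { refl → there (here refl) }) (∈-upTo⁺ k<n)))

∈-ground⁻ : ∀ {n x} → x ∈ ground n → InGround n x
∈-ground⁻ (here refl) = z≤n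
∈-ground⁻ {n} (there x∈) with find (∈-concatMap⁻ signedPair {xs = upTo n} x∈)
... | k , k∈ , here refl         = ∈-upTo⁻ k∈
... | k , k∈ , there (here refl) = ∈-upTo⁻ k∈

filterᵇ-isPos-pairs : ∀ (f : ℕ → ℕ) m →
  filterᵇ isPos (concatMap signedPair (applyUpTo (suc ∘ f) m)) ≡ applyUpTo (pos ∘ f) m
filterᵇ-isPos-pairs f zero    = refl
filterᵇ-isPos-pairs f (suc m) = cong (pos (f 0) ∷_) (filterᵇ-isPos-pairs (f ∘ suc) m)

filterᵇ-isPos-ground : ∀ n → filterᵇ isPos (ground n) ≡ applyUpTo pos (n ∸ 1)
filterᵇ-isPos-ground zero    = refl
filterᵇ-isPos-ground (suc m) = filterᵇ-isPos-pairs (λ i → i) m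

module Positives (n : ℕ) where

  M : ℕ
  M = n ∸ 1

  positives≡ : positives n ≡ applyUpTo pos M
  positives≡ = map-upTo pos M

  onPositives : ∀ {B : Set} (F G : List ℤ → B) → F (positives n) ≡ G (positives n) →
    F (applyUpTo pos M) ≡ G (applyUpTo pos M)
  onPositives F G = subst (λ xs → F xs ≡ G xs) positives≡

  pos∈ : ∀ {k} → InRange n k → pos k ∈ applyUpTo pos M
  pos∈ = ∈-applyUpTo⁺ pos ∘ InRange⇒<

  LeastPos : (ℤ → ℤ → Bool) → ℕ → Set
  LeastPos R k = ∀ {l} → l < k → R (pos k) (pos l) ≡ false

  NearestEarlier : (ℤ → ℤ → Bool) → ℕ → ℕ → Set
  NearestEarlier R p q = q < p × R (pos p) (pos q) ≡ true × (∀ {j} → q < j → j < p → R (pos p) (pos j) ≡ false)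

  nearestEarlier? : ∀ R p → (∃[ q ] NearestEarlier R p q) ⊎ LeastPos R p
  nearestEarlier? R p with greatest (λ j → R (pos p) (pos j)) p
  ... | inj₁ (q , q<p , p∼q , later) = inj₁ (q , q<p , p∼q , later)
  ... | inj₂ none                    = inj₂ none

  LeastPos-transfer : ∀ R R′ {k} → (∀ {l} → l < k → R (pos k) (pos l) ≡ R′ (pos k) (pos l)) →
    LeastPos R k → LeastPos R′ k
  LeastPos-transfer R R′ agree lk l<k = trans (sym (agree l<k)) (lk l<k)

  module _ (R : ℤ → ℤ → Bool) {k : ℕ} (bk : InRange n k) where

    private
      earlierRelated : ℤ → Bool
      earlierRelated q = not (pos k ℤ.≤ᵇ q) ∧ R (pos k) q

    isLeastPos⇒LeastPos : isLeastPos n R (pos k) ≡ true → LeastPos R k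
    isLeastPos⇒LeastPos least {l} l<k with R (pos k) (pos l) in kl
    ... | false = refl
    ... | true  = ⊥-elim (true≢false (trans (sym related) (any-false⁻ earlierRelated _ none (∈-applyUpTo⁺ pos l<M))))
      where
      none : any earlierRelated (applyUpTo pos M) ≡ false
      none = subst (λ xs → any earlierRelated xs ≡ false) positives≡ (not-true least)
      related : earlierRelated (pos l) ≡ true
      related = cong₂ _∧_ (cong not (pos≰ᵇpos l<k)) kl
      l<M = ℕP.<-trans l<k (InRange⇒< bk)

    LeastPos⇒isLeastPos : LeastPos R k → isLeastPos n R (pos k) ≡ true
    LeastPos⇒isLeastPos least = not-false (subst (λ xs → any earlierRelated xs ≡ false) (sym positives≡)
      (any-false earlierRelated _ (applyUpTo⁺₁ pos M unrelated)))
      where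
      unrelated : ∀ {i} → i < M → earlierRelated (pos i) ≡ false
      unrelated {i} _ with ℕP.<-cmp i k
      ... | tri< i<k _ _    = trans (cong (not (pos k ℤ.≤ᵇ pos i) ∧_) (least i<k)) (∧-zeroʳ _)
      ... | tri≈ _ refl _   = cong (λ b → not b ∧ R (pos k) (pos i)) (pos≤ᵇpos {i} ℕP.≤-refl)
      ... | tri> _ _ k<i    = cong (λ b → not b ∧ R (pos k) (pos i)) (pos≤ᵇpos (ℕP.<⇒≤ k<i))

  isLeastPos-cong : ∀ R R′ {k} → InRange n k → (∀ {l} → l < k → R (pos k) (pos l) ≡ R′ (pos k) (pos l)) →
    isLeastPos n R (pos k) ≡ isLeastPos n R′ (pos k)
  isLeastPos-cong R R′ bk agree = ≡-from-≡true
    (λ e → LeastPos⇒isLeastPos R′ bk (LeastPos-transfer R R′ agree (isLeastPos⇒LeastPos R bk e)))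
    (λ e → LeastPos⇒isLeastPos R bk (LeastPos-transfer R′ R (sym ∘ agree) (isLeastPos⇒LeastPos R′ bk e)))

  nonswitching : (ℤ → ℤ → Bool) → ℤ → Bool
  nonswitching R p = all isPos (block n R p)

  meetsUnit : (ℤ → ℤ → Bool) → ℤ → Bool
  meetsUnit R p = R p (+ 1) ∨ R p -[1+ 0 ]

  leastOfNonswitching leastOfSwitching leastOfUnitBlock : (ℤ → ℤ → Bool) → ℤ → Bool
  leastOfNonswitching R p = isLeastPos n R p ∧ nonswitching R p
  leastOfSwitching    R p = isLeastPos n R p ∧ not (nonswitching R p)
  leastOfUnitBlock    R p = isLeastPos n R p ∧ meetsUnit R p

  units : (ℤ → ℤ → Bool) → ℤ → Bool × Bool
  units R p = R p (+ 1) , R p -[1+ 0 ]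

  posCount : (ℤ → ℤ → Bool) → ℕ → ℕ
  posCount R k = countᵇ (R (pos k)) (applyUpTo pos M)

  posCount-block : ∀ R k → length (filterᵇ isPos (block n R (pos k))) ≡ posCount R k
  posCount-block R k = cong length (trans (filterᵇ-comm isPos (R (pos k)) (ground n))
                                          (cong (filterᵇ (R (pos k))) (filterᵇ-isPos-ground n)))

  posCount-nonswitching : ∀ R k → nonswitching R (pos k) ≡ true → length (block n R (pos k)) ≡ posCount R k
  posCount-nonswitching R k ns =
    trans (cong length (sym (filterᵇ-all isPos (block n R (pos k)) ns))) (posCount-block R k)

  ∼nonpos⇒switching : ∀ R k {u} → InGround n u → isPos u ≡ false → R (pos k) u ≡ true →
    nonswitching R (pos k) ≡ false
  ∼nonpos⇒switching R k {u} gu u≤1 k∼u with nonswitching R (pos k) in ns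
  ... | false = refl
  ... | true  = ⊥-elim (false≢true (trans (sym u≤1) (all-filterᵇ-true isPos (R (pos k)) (ground n) ns (∈-ground⁺ u gu) k∼u)))

  switching⇒∼nonpos : ∀ R k → nonswitching R (pos k) ≡ false →
    ∃[ u ] InGround n u × R (pos k) u ≡ true × isPos u ≡ false
  switching⇒∼nonpos R k sw with all-filterᵇ-false isPos (R (pos k)) (ground n) sw
  ... | u , u∈ , k∼u , u≤1 = u , ∈-ground⁻ u∈ , k∼u , u≤1

-- Blocks of one nonnesting partition

module Blocks (n : ℕ) (two : 2 ≤ n) (R : ℤ → ℤ → Bool) (P : NonnestingPartition n R) where

  open Positives n
  open NonnestingPartition P public

  g₀ : InGround n (+ 0)
  g₀ = z≤n

  g₁ : InGround n (+ 1)
  g₁ = ℕP.≤-trans (s≤s z≤n) two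

  g₋₁ : InGround n -[1+ 0 ]
  g₋₁ = g₁

  ∼-comm : ∀ {s t} → InGround n s → InGround n t → R s t ≡ R t s
  ∼-comm gs gt = ≡-from-≡true (symmetric gs gt) (symmetric gt gs)

  ∼-congˡ : ∀ {s t u} → InGround n s → InGround n t → InGround n u → R s t ≡ true → R s u ≡ R t u
  ∼-congˡ gs gt gu s∼t = ≡-from-≡true (transitive gt gs gu (symmetric gs gt s∼t)) (transitive gs gt gu s∼t)

  ∼-congʳ : ∀ {s t u} → InGround n s → InGround n t → InGround n u → R t u ≡ true → R s t ≡ R s u
  ∼-congʳ gs gt gu t∼u = ≡-from-≡true (λ s∼t → transitive gs gt gu s∼t t∼u)
                                      (λ s∼u → transitive gs gu gt s∼u (symmetric gt gu t∼u))

  ∼-neg : ∀ {s t} → InGround n s → InGround n t → R (- s) (- t) ≡ R s t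
  ∼-neg {s} {t} gs gt = ≡-from-≡true
    (λ -s∼-t → subst₂ (λ a b → R a b ≡ true) (neg-involutive s) (neg-involutive t)
                      (neg-closed (InGround-neg s gs) (InGround-neg t gt) -s∼-t))
    (neg-closed gs gt)

  LeastPos-unique : ∀ {k l} → InRange n k → InRange n l → LeastPos R k → LeastPos R l →
    R (pos k) (pos l) ≡ true → k ≡ l
  LeastPos-unique {k} {l} bk bl lk ll k∼l with ℕP.<-cmp k l
  ... | tri< k<l _ _ = ⊥-elim (true≢false (trans (sym (symmetric bk bl k∼l)) (ll k<l)))
  ... | tri≈ _ k≡l _ = k≡l
  ... | tri> _ _ l<k = ⊥-elim (true≢false (trans (sym k∼l) (lk l<k)))

  leastOfBlock : ∀ {k} → InRange n k → ∃[ m ] m ≤ k × LeastPos R m × R (pos k) (pos m) ≡ true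
  leastOfBlock {k} bk with least (λ i → R (pos k) (pos i)) (suc k)
  ... | inj₂ none = ⊥-elim (true≢false (trans (sym (reflexive bk)) (none (ℕP.n<1+n k))))
  ... | inj₁ (m , s≤s m≤k , k∼m , first) = m , m≤k , leastPos , k∼m
    where
    bm = InRange-≤ m≤k bk
    leastPos : LeastPos R m
    leastPos {l} l<m with R (pos m) (pos l) in m∼l
    ... | false = refl
    ... | true  = ⊥-elim (true≢false (trans (sym (transitive bk bm (InRange-< l<m bm) k∼m m∼l)) (first l<m)))

  edge-into-pos : ∀ {x p} → InGround n x → InRange n p → R (pos p) x ≡ true → x ≺ pos p →
    (∀ {u} → InGround n u → x ≺ u → u ≺ pos p → R (pos p) u ≡ false) → Edge n R x (pos p)
  edge-into-pos gx bp p∼x x≺p gap = gx , bp , symmetric bp gx p∼x , x≺p , λ u gu x∼u (x≺u , u≺p) →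
    true≢false (trans (sym (transitive bp gx gu p∼x x∼u)) (gap gu x≺u u≺p))

  edge-pos-pos : ∀ {p q} → InRange n p → NearestEarlier R p q → Edge n R (pos q) (pos p)
  edge-pos-pos {p} {q} bp (q<p , p∼q , later) = edge-into-pos (InRange-< q<p bp) bp p∼q (pos≺pos q<p) gap
    where
    gap : ∀ {u} → InGround n u → pos q ≺ u → u ≺ pos p → R (pos p) u ≡ false
    gap {u} _ q≺u u≺p with pos≺pos⇒pos u q≺u u≺p
    ... | _ , refl , q<l , l<p = later q<l l<p

  edge-unit-pos : ∀ {x p} → level x ≡ + 0 → InGround n x → x ≺ pos p → InRange n p → LeastPos R p →
    R (pos p) x ≡ true → Edge n R x (pos p)
  edge-unit-pos {x} {p} lx gx x≺p bp lp p∼x = edge-into-pos gx bp p∼x x≺p gap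
    where
    gap : ∀ {u} → InGround n u → x ≺ u → u ≺ pos p → R (pos p) u ≡ false
    gap {u} _ x≺u u≺p with unit≺pos⇒pos u lx x≺u u≺p
    ... | _ , refl , l<p = lp l<p

  nearest-after : ∀ {q r} → InRange n r → q < r → R (pos q) (pos r) ≡ true →
    ∃[ j ] j ≤ r × NearestEarlier R j q
  nearest-after {q} {r} br q<r q∼r with least (λ i → (q ℕ.<ᵇ i) ∧ R (pos q) (pos i)) (suc r)
  ... | inj₂ none = ⊥-elim (true≢false (trans (sym (cong₂ _∧_ (T⇒≡true (ℕP.<⇒<ᵇ q<r)) q∼r)) (none (ℕP.n<1+n r))))
  ... | inj₁ (j , s≤s j≤r , found , first) = j , j≤r , q<j , symmetric bq bj (∧-trueʳ found) , gap
    where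
    q<j = ℕP.<ᵇ⇒< q j (subst T (sym (∧-trueˡ found)) _)
    bj = InRange-≤ j≤r br
    bq = InRange-< q<j bj
    gap : ∀ {i} → q < i → i < j → R (pos j) (pos i) ≡ false
    gap {i} q<i i<j with R (pos j) (pos i) in j∼i
    ... | false = refl
    ... | true  = ⊥-elim (true≢false (trans (sym (cong₂ _∧_ (T⇒≡true (ℕP.<⇒<ᵇ q<i))
                    (transitive bq bj (InRange-< i<j bj) (∧-trueʳ found) j∼i))) (first i<j)))

  -- Otherwise the edge from q to the next element of its block would nest over q′ → p.
  mate-before-edge-end : ∀ {p q q′ r} → InRange n p → NearestEarlier R p q′ → q < q′ →
    InRange n r → p < r → R (pos q) (pos r) ≡ true → ∃[ j ] q < j × j ≤ p × R (pos q) (pos j) ≡ true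
  mate-before-edge-end {p} bp q′→p@(q′<p , _) q<q′ br p<r q∼r
    with nearest-after br (ℕP.<-trans q<q′ (ℕP.<-trans q′<p p<r)) q∼r
  ... | j , j≤r , q→j@(q<j , j∼q , _) with j ℕ.≤? p
  ...   | yes j≤p = j , q<j , j≤p , symmetric (InRange-≤ j≤p bp) (InRange-< q<j (InRange-≤ j≤p bp)) j∼q
  ...   | no j≰p  = ⊥-elim (nonnesting _ _ _ _ (edge-pos-pos (InRange-≤ j≤r br) q→j) (edge-pos-pos bp q′→p)
                                      (pos≺pos q<q′) (pos≺pos q′<p) (pos≺pos (ℕP.≰⇒> j≰p)))

  -- pos k opens a switching block that avoids ±1; such blocks are matched with their negatives.
  record SwitchingOffUnit (k : ℕ) : Set where
    constructor switchingOffUnit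
    field
      inRange    : InRange n k
      leastPos   : LeastPos R k
      switching  : nonswitching R (pos k) ≡ false
      ≁one       : R (pos k) (+ 1) ≡ false
      ≁minus-one : R (pos k) -[1+ 0 ] ≡ false

  edge-neg-pos : ∀ {k v} → SwitchingOffUnit k → InRange n v → R (pos k) (neg v) ≡ true →
    (∀ {l} → l < v → R (pos k) (neg l) ≡ false) → Edge n R (neg v) (pos k)
  edge-neg-pos {k} {v} (switchingOffUnit bk lk _ ≁one ≁minus-one) bv k∼v first =
    edge-into-pos bv bk k∼v neg≺pos gap
    where
    gap : ∀ {u} → InGround n u → neg v ≺ u → u ≺ pos k → R (pos k) u ≡ false
    gap {u} _ v≺u u≺k with below u u≺k
    ... | one          = ≁one
    ... | minus-one    = ≁minus-one
    ... | positive l<k = lk l<k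
    ... | negative l   = first (neg≺neg⇒< v≺u)

  ∼neg-flip : ∀ {a u} → InRange n a → InRange n u → R (pos a) (neg u) ≡ true → R (pos u) (neg a) ≡ true
  ∼neg-flip ba bu a∼-u = symmetric ba bu (neg-closed ba bu a∼-u)

  offUnit⇒∼neg : ∀ {m} → SwitchingOffUnit m → ∃[ v ] InRange n v × R (pos m) (neg v) ≡ true
  offUnit⇒∼neg {m} (switchingOffUnit bm _ sw ≁one ≁minus-one) with switching⇒∼nonpos R m sw
  ... | + zero         , _  , m∼0  , _ = m , bm , transitive bm g₀ bm m∼0 (neg-closed g₀ bm (symmetric bm g₀ m∼0))
  ... | -[1+ suc v ]   , bv , m∼-v , _ = v , bv , m∼-v
  ... | + suc zero     , _  , m∼1  , _ = ⊥-elim (true≢false (trans (sym m∼1) ≁one))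
  ... | -[1+ zero ]    , _  , m∼-1 , _ = ⊥-elim (true≢false (trans (sym m∼-1) ≁minus-one))
  ... | + suc (suc _)  , _  , _    , ()

  partner : ∀ {m} → SwitchingOffUnit m → ∃[ u ] InRange n u × LeastPos R u × R (pos m) (neg u) ≡ true
  partner sw with offUnit⇒∼neg sw
  ... | v , bv , m∼-v with leastOfBlock bv
  ...   | u , u≤v , lu , v∼u = u , bu , (λ {l} → lu {l}) ,
                               transitive (SwitchingOffUnit.inRange sw) bv bu m∼-v (neg-closed bv bu v∼u)
    where
    bu = InRange-≤ u≤v bv

  partner-first : ∀ {a u} → InRange n a → InRange n u → LeastPos R u → R (pos a) (neg u) ≡ true →
    ∀ {l} → l < u → R (pos a) (neg l) ≡ false
  partner-first {a} ba bu lu a∼-u {l} l<u with R (pos a) (neg l) in a∼-l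
  ... | false = refl
  ... | true  = ⊥-elim (true≢false (trans (sym (neg-closed bu bl (transitive bu ba bl (symmetric ba bu a∼-u) a∼-l))) (lu l<u)))
    where
    bl = InRange-< l<u bu

  partner-unique : ∀ {a u v} → InRange n a → InRange n u → InRange n v → LeastPos R u → LeastPos R v →
    R (pos a) (neg u) ≡ true → R (pos a) (neg v) ≡ true → u ≡ v
  partner-unique ba bu bv lu lv a∼-u a∼-v =
    LeastPos-unique bu bv lu lv (neg-closed bu bv (transitive bu ba bv (symmetric ba bu a∼-u) a∼-v))

  partner-injective : ∀ {a b u} → InRange n a → InRange n b → InRange n u → LeastPos R a → LeastPos R b →
    R (pos a) (neg u) ≡ true → R (pos b) (neg u) ≡ true → a ≡ b
  partner-injective ba bb bu la lb a∼-u b∼-u =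
    LeastPos-unique ba bb la lb (transitive ba bu bb a∼-u (symmetric bb bu b∼-u))

  partner-offUnit : ∀ {m u} → SwitchingOffUnit m → InRange n u → LeastPos R u → R (pos m) (neg u) ≡ true →
    SwitchingOffUnit u
  partner-offUnit {m} {u} (switchingOffUnit bm _ _ ≁one ≁minus-one) bu lu m∼-u =
    switchingOffUnit bu lu (∼nonpos⇒switching R u bm refl u∼-m) (≁unit g₁ ≁minus-one) (≁unit g₋₁ ≁one)
    where
    u∼-m = ∼neg-flip bm bu m∼-u
    ≁unit : ∀ {x} → InGround n x → R (pos m) (- x) ≡ false → R (pos u) x ≡ false
    ≁unit {x} gx m≁-x with R (pos u) x in u∼x
    ... | false = refl
    ... | true  = ⊥-elim (true≢false (trans (sym (transitive bm bu (InGround-neg x gx) m∼-u (neg-closed bu gx u∼x))) m≁-x))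

  switching⇒edge-from-below : ∀ {s} → InRange n s → LeastPos R s → nonswitching R (pos s) ≡ false →
    ∃[ x ] Edge n R x (pos s) × (∀ {q} → x ≺ pos q)
  switching⇒edge-from-below {s} bs ls sw with R (pos s) (+ 1) in s∼1
  ... | true = + 1 , edge-unit-pos refl g₁ one≺pos bs ls s∼1 , one≺pos
  ... | false with R (pos s) -[1+ 0 ] in s∼-1
  ...   | true  = -[1+ 0 ] , edge-unit-pos refl g₋₁ minus-one≺pos bs ls s∼-1 , minus-one≺pos
  ...   | false with partner (switchingOffUnit bs ls sw s∼1 s∼-1)
  ...     | u , bu , lu , s∼-u =
    neg u , edge-neg-pos (switchingOffUnit bs ls sw s∼1 s∼-1) bu s∼-u (partner-first bs bu lu s∼-u) , neg≺pos

  switching⇒earlier-LeastPos : ∀ {s p} → InRange n s → LeastPos R s → nonswitching R (pos s) ≡ false →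
    p < s → LeastPos R p
  switching⇒earlier-LeastPos {s} {p} bs ls sw p<s {q} q<p with R (pos p) (pos q) in p∼q
  ... | false = refl
  ... | true with nearestEarlier? R p
  ...   | inj₂ lp = ⊥-elim (true≢false (trans (sym p∼q) (lp q<p)))
  ...   | inj₁ (q′ , q′→p@(q′<p , _)) with switching⇒edge-from-below bs ls sw
  ...     | x , x→s , x≺ = ⊥-elim (nonnesting _ _ _ _ x→s (edge-pos-pos (InRange-< p<s bs) q′→p)
                                     x≺ (pos≺pos q′<p) (pos≺pos p<s))

  partner-antitone : ∀ {a b u v} → SwitchingOffUnit a → SwitchingOffUnit b → a < b →
    InRange n u → InRange n v → LeastPos R u → LeastPos R v →
    R (pos a) (neg u) ≡ true → R (pos b) (neg v) ≡ true → v < u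
  partner-antitone {u = u} {v} oa ob a<b bu bv lu lv a∼-u b∼-v with ℕP.<-cmp u v
  ... | tri> _ _ v<u = v<u
  ... | tri≈ _ refl _ = ⊥-elim (ℕP.<-irrefl (partner-injective ba bb bu la lb a∼-u b∼-v) a<b)
    where
    open SwitchingOffUnit oa using () renaming (inRange to ba; leastPos to la)
    open SwitchingOffUnit ob using () renaming (inRange to bb; leastPos to lb)
  ... | tri< u<v _ _ = ⊥-elim (nonnesting _ _ _ _
          (edge-neg-pos ob bv b∼-v (partner-first bb bv lv b∼-v))
          (edge-neg-pos oa bu a∼-u (partner-first ba bu lu a∼-u))
          (neg≺neg u<v) neg≺pos (pos≺pos a<b))
    where
    ba = SwitchingOffUnit.inRange oa
    bb = SwitchingOffUnit.inRange ob

  offUnit⇒no-earlier-unit-block : ∀ {a b} → SwitchingOffUnit b → a < b → InRange n a → LeastPos R a →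
    R (pos a) (+ 1) ≡ true ⊎ R (pos a) -[1+ 0 ] ≡ true → ⊥
  offUnit⇒no-earlier-unit-block {a} ob a<b ba la a∼unit with partner ob
  ... | u , bu , lu , b∼-u with a∼unit
  ...   | inj₁ a∼1  = nonnesting _ _ _ _ b-edge (edge-unit-pos refl g₁ one≺pos ba la a∼1) neg≺one one≺pos (pos≺pos a<b)
    where
    b-edge = edge-neg-pos ob bu b∼-u (partner-first (SwitchingOffUnit.inRange ob) bu lu b∼-u)
  ...   | inj₂ a∼-1 = nonnesting _ _ _ _ b-edge (edge-unit-pos refl g₋₁ minus-one≺pos ba la a∼-1)
                                    neg≺minus-one minus-one≺pos (pos≺pos a<b)
    where
    b-edge = edge-neg-pos ob bu b∼-u (partner-first (SwitchingOffUnit.inRange ob) bu lu b∼-u)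

  unit⇒switching : ∀ {k} → meetsUnit R (pos k) ≡ true → nonswitching R (pos k) ≡ false
  unit⇒switching {k} k∼unit with ∨-true k∼unit
  ... | inj₁ k∼1  = ∼nonpos⇒switching R k g₁ refl k∼1
  ... | inj₂ k∼-1 = ∼nonpos⇒switching R k g₋₁ refl k∼-1

  zero∼≡∼neg : ∀ {x} → InGround n x → R (+ 0) x ≡ R x (- x)
  zero∼≡∼neg {x} gx = ≡-from-≡true
    (λ 0∼x → transitive gx g₀ (InGround-neg x gx) (symmetric g₀ gx 0∼x) (neg-closed g₀ gx 0∼x))
    (zero-block gx)

  nonswitching⇒≁neg : ∀ {m l} → InRange n m → InRange n l → nonswitching R (pos m) ≡ true →
    R (pos m) (neg l) ≡ false
  nonswitching⇒≁neg {m} {l} bm bl ns with R (pos m) (neg l) in m∼-l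
  ... | false = refl
  ... | true  = ⊥-elim (true≢false (trans (sym ns) (∼nonpos⇒switching R m bl refl m∼-l)))

  unit-block-pos∼neg : ∀ {k l} → InRange n k → InRange n l → meetsUnit R (pos k) ≡ true →
    R (pos k) (neg l) ≡ (R (pos k) (+ 1) ∧ R (pos l) -[1+ 0 ] ∨ R (pos k) -[1+ 0 ] ∧ R (pos l) (+ 1))
  unit-block-pos∼neg {k} {l} bk bl k∼unit = ≡-from-≡true to from
    where
    via : ∀ {x} → InGround n x → R (pos k) x ≡ true → R (pos k) (neg l) ≡ true → R (pos l) (- x) ≡ true
    via {x} gx k∼x k∼-l = neg-closed bl gx (transitive bl bk gx (symmetric bk bl k∼-l) k∼x)
    to : R (pos k) (neg l) ≡ true →
      (R (pos k) (+ 1) ∧ R (pos l) -[1+ 0 ] ∨ R (pos k) -[1+ 0 ] ∧ R (pos l) (+ 1)) ≡ true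
    to k∼-l with ∨-true k∼unit
    ... | inj₁ k∼1  = ∨-trueˡ (∧-true k∼1 (via g₁ k∼1 k∼-l))
    ... | inj₂ k∼-1 = ∨-trueʳ (∧-true k∼-1 (via g₋₁ k∼-1 k∼-l))
    back : ∀ {x} → InGround n x → R (pos k) x ≡ true → R (pos l) (- x) ≡ true → R (pos k) (neg l) ≡ true
    back {x} gx k∼x l∼-x =
      transitive bk gx bl k∼x (symmetric bl gx (subst (λ y → R (- pos l) y ≡ true) (neg-involutive x)
                                                   (neg-closed bl (InGround-neg x gx) l∼-x)))
    from : (R (pos k) (+ 1) ∧ R (pos l) -[1+ 0 ] ∨ R (pos k) -[1+ 0 ] ∧ R (pos l) (+ 1)) ≡ true →
      R (pos k) (neg l) ≡ true
    from e with ∨-true e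
    ... | inj₁ both = back g₁ (∧-trueˡ both) (∧-trueʳ both)
    ... | inj₂ both = back g₋₁ (∧-trueˡ both) (∧-trueʳ both)

  zero∼one⇒units : R (+ 0) (+ 1) ≡ true → ∃[ k ] InRange n k × R (pos k) (+ 1) ≡ true × R (pos k) -[1+ 0 ] ≡ true
  zero∼one⇒units 0∼1 with zero∼one⇒zero∼pos 0∼1
  ... | k , bk , 0∼k = k , bk , transitive bk g₀ g₁ k∼0 0∼1 , transitive bk g₀ g₋₁ k∼0 (neg-closed g₀ g₁ 0∼1)
    where
    k∼0 = symmetric g₀ bk 0∼k

  units⇒zero∼one : ∀ {k} → InRange n k → R (pos k) (+ 1) ≡ true → R (pos k) -[1+ 0 ] ≡ true → R (+ 0) (+ 1) ≡ true
  units⇒zero∼one bk k∼1 k∼-1 =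
    subst (_≡ true) (sym (zero∼≡∼neg g₁)) (transitive g₁ bk g₋₁ (symmetric bk g₁ k∼1) k∼-1)

-- Comparing two partitions with the same statistics

module Compare (n : ℕ) (two : 2 ≤ n) (R R′ : ℤ → ℤ → Bool)
  (P : NonnestingPartition n R) (P′ : NonnestingPartition n R′)
  (a≡ : aStat n R ≡ aStat n R′) (μ≡ : μStat n R ≡ μStat n R′)
  (ν≡ : νStat n R ≡ νStat n R′) (c≡ : cStat n R ≡ cStat n R′) where

  open Positives n
  module X = Blocks n two R P
  module Y = Blocks n two R′ P′

  leastOfNonswitching-agree : ∀ {k} → InRange n k →
    leastOfNonswitching R (pos k) ≡ leastOfNonswitching R′ (pos k)
  leastOfNonswitching-agree bk = filterᵇ-≡⇒pointwise _ _ pos pos-injective M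
    (onPositives (filterᵇ (leastOfNonswitching R)) (filterᵇ (leastOfNonswitching R′)) a≡) (InRange⇒< bk)

  posCount-agree-nonswitching : ∀ {k} → InRange n k → leastOfNonswitching R (pos k) ≡ true →
    posCount R k ≡ posCount R′ k
  posCount-agree-nonswitching {k} bk ns = begin
    posCount R k               ≡⟨ sym (posCount-nonswitching R k (∧-trueʳ ns)) ⟩
    length (block n R (pos k))  ≡⟨ sizes ⟩
    length (block n R′ (pos k)) ≡⟨ posCount-nonswitching R′ k (∧-trueʳ ns′) ⟩
    posCount R′ k              ∎
    where
    open ≡-Reasoning
    size : (ℤ → ℤ → Bool) → ℤ → ℕ
    size X p = length (block n X p)
    ns′ = trans (sym (leastOfNonswitching-agree bk)) ns
    sizes = map-filterᵇ-≡-at (size R) (size R′) _ _ pos M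
      (onPositives (map (size R) ∘ filterᵇ (leastOfNonswitching R)) (map (size R′) ∘ filterᵇ (leastOfNonswitching R′)) μ≡)
      (InRange⇒< bk) (λ i<k → leastOfNonswitching-agree (InRange-< i<k bk)) ns ns′

  posCount-agree-switching : ∀ {k} → InRange n k →
    (∀ {i} → i < k → leastOfSwitching R (pos i) ≡ leastOfSwitching R′ (pos i)) →
    leastOfSwitching R (pos k) ≡ true → leastOfSwitching R′ (pos k) ≡ true → posCount R k ≡ posCount R′ k
  posCount-agree-switching {k} bk earlier sw sw′ =
    trans (sym (posCount-block R k)) (trans sizes (posCount-block R′ k))
    where
    size : (ℤ → ℤ → Bool) → ℤ → ℕ
    size X p = length (filterᵇ isPos (block n X p))
    sizes = map-filterᵇ-≡-at (size R) (size R′) _ _ pos M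
      (onPositives (map (size R) ∘ filterᵇ (leastOfSwitching R)) (map (size R′) ∘ filterᵇ (leastOfSwitching R′)) ν≡)
      (InRange⇒< bk) earlier sw sw′

  #switching-agree : countᵇ (leastOfSwitching R) (applyUpTo pos M) ≡ countᵇ (leastOfSwitching R′) (applyUpTo pos M)
  #switching-agree = onPositives (countᵇ (leastOfSwitching R)) (countᵇ (leastOfSwitching R′))
    (map-filterᵇ-≡⇒countᵇ-≡ _ _ (leastOfSwitching R) (leastOfSwitching R′) (positives n) ν≡)

  #unitBlocks-agree : countᵇ (leastOfUnitBlock R) (applyUpTo pos M) ≡ countᵇ (leastOfUnitBlock R′) (applyUpTo pos M)
  #unitBlocks-agree = onPositives (countᵇ (leastOfUnitBlock R)) (countᵇ (leastOfUnitBlock R′))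
    (map-filterᵇ-≡⇒countᵇ-≡ _ _ (leastOfUnitBlock R) (leastOfUnitBlock R′) (positives n) c≡)

  AgreeBelow : ℕ → Set
  AgreeBelow p = ∀ {k l} → k < p → l < p → InRange n k → InRange n l → R (pos k) (pos l) ≡ R′ (pos k) (pos l)

  module _ {p : ℕ} (agree : AgreeBelow p) where

    LeastPos-agree : ∀ {m} → m < p → InRange n m → LeastPos R m → LeastPos R′ m
    LeastPos-agree m<p bm = LeastPos-transfer R R′ λ l<m → agree m<p (ℕP.<-trans l<m m<p) bm (InRange-< l<m bm)

    leastOfSwitching-agree : ∀ {i} → i < p → InRange n i → leastOfSwitching R (pos i) ≡ leastOfSwitching R′ (pos i)
    leastOfSwitching-agree i<p bi = ∧-not-cong
      (isLeastPos-cong R R′ bi λ j<i → agree i<p (ℕP.<-trans j<i i<p) bi (InRange-< j<i bi))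
      (leastOfNonswitching-agree bi)

    posCount-agree : ∀ {m} → m < p → InRange n m → LeastPos R m → posCount R m ≡ posCount R′ m
    posCount-agree {m} m<p bm lm with leastOfNonswitching R (pos m) in ns
    ... | true  = posCount-agree-nonswitching bm ns
    ... | false = posCount-agree-switching bm (λ i<m → leastOfSwitching-agree (ℕP.<-trans i<m m<p) (InRange-< i<m bm)) sw sw′
      where
      sw = ∧-not-true (LeastPos⇒isLeastPos R bm lm) ns
      sw′ = ∧-not-true (LeastPos⇒isLeastPos R′ bm (LeastPos-agree m<p bm lm)) (trans (sym (leastOfNonswitching-agree bm)) ns)

    LeastPos-at : InRange n p → LeastPos R p → LeastPos R′ p
    LeastPos-at bp lp {q} q<p with R′ (pos p) (pos q) in p∼′q
    ... | false = refl
    ... | true  = ⊥-elim (ℕP.<-irrefl (sym #switching-agree) fewer)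
      where
      notLeast′ : isLeastPos n R′ (pos p) ≡ false
      notLeast′ with isLeastPos n R′ (pos p) in least′
      ... | false = refl
      ... | true  = ⊥-elim (true≢false (trans (sym p∼′q) (isLeastPos⇒LeastPos R′ bp least′ q<p)))
      sw′ : leastOfSwitching R′ (pos p) ≡ false
      sw′ rewrite notLeast′ = refl
      sw : leastOfSwitching R (pos p) ≡ true
      sw = ∧-not-true (LeastPos⇒isLeastPos R bp lp)
             (trans (leastOfNonswitching-agree bp) (cong (_∧ nonswitching R′ (pos p)) notLeast′))
      -- Below the least element of a switching block every positive opens a block, so R′,
      -- in which p does not, opens no switching block after p.
      R′⇒R : ∀ {i} → i < M → leastOfSwitching R′ (pos i) ≡ true → leastOfSwitching R (pos i) ≡ true
      R′⇒R {i} i<M sw′ᵢ with ℕP.<-cmp i p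
      ... | tri< i<p _ _  = trans (leastOfSwitching-agree i<p (<⇒InRange i<M)) sw′ᵢ
      ... | tri≈ _ refl _ = ⊥-elim (true≢false (trans (sym sw′ᵢ) sw′))
      ... | tri> _ _ p<i  = ⊥-elim (true≢false (trans (sym p∼′q)
              (Y.switching⇒earlier-LeastPos bi (isLeastPos⇒LeastPos R′ bi (∧-trueˡ sw′ᵢ))
                                             (not-true (∧-trueʳ sw′ᵢ)) p<i q<p)))
        where
        bi = <⇒InRange i<M
      fewer : countᵇ (leastOfSwitching R′) (applyUpTo pos M) < countᵇ (leastOfSwitching R) (applyUpTo pos M)
      fewer = countᵇ-< _ _ _ (applyUpTo⁺₁ pos M R′⇒R) (pos∈ bp) sw′ sw

    -- If R′ attached p to a later element than R did, the block that p joins in R loses p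
    -- in R′ and, by mate-before-edge-end, gains nothing, so its size changes.
    nearestEarlier-≮ : ∀ {q q′} → InRange n p → NearestEarlier R p q → NearestEarlier R′ p q′ → q < q′ → ⊥
    nearestEarlier-≮ {q} {q′} bp (q<p , p∼q , nearest) q′→p@(q′<p , p∼′q′ , _) q<q′
      with X.leastOfBlock (InRange-< q<p bp)
    ... | m , m≤q , lm , q∼m = ℕP.<-irrefl (sym (posCount-agree m<p bm lm)) smaller
      where
      bq = InRange-< q<p bp
      m<p = ℕP.≤-<-trans m≤q q<p
      bm = InRange-< m<p bp
      q∼′m : R′ (pos q) (pos m) ≡ true
      q∼′m = trans (sym (agree q<p m<p bq bm)) q∼m
      q≁′ : ∀ {j} → q < j → j < p → R′ (pos q) (pos j) ≡ false
      q≁′ {j} q<j j<p with R′ (pos q) (pos j) in q∼′j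
      ... | false = refl
      ... | true  = ⊥-elim (true≢false (trans (sym p∼j) (nearest q<j j<p)))
        where
        bj = InRange-< j<p bp
        p∼j = X.transitive bp bq bj p∼q (trans (agree q<p j<p bq bj) q∼′j)
      m≁′p : R′ (pos m) (pos p) ≡ false
      m≁′p with R′ (pos m) (pos p) in m∼′p
      ... | false = refl
      ... | true  = ⊥-elim (true≢false (trans (sym q∼′q′) (q≁′ q<q′ q′<p)))
        where
        bq′ = InRange-< q′<p bp
        q∼′q′ = Y.transitive bq bp bq′ (Y.transitive bq bm bp q∼′m m∼′p) p∼′q′
      m≁′later : ∀ {r} → p < r → r < M → R′ (pos m) (pos r) ≡ false
      m≁′later {r} p<r r<M with R′ (pos m) (pos r) in m∼′r
      ... | false = refl
      ... | true with Y.mate-before-edge-end bp q′→p q<q′ (<⇒InRange r<M) p<r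
                      (Y.transitive bq bm (<⇒InRange r<M) q∼′m m∼′r)
      ...   | j , q<j , j≤p , q∼′j with ℕP.m≤n⇒m<n∨m≡n j≤p
      ...     | inj₁ j<p  = ⊥-elim (true≢false (trans (sym q∼′j) (q≁′ q<j j<p)))
      ...     | inj₂ refl = ⊥-elim (true≢false (trans (sym (Y.transitive bm bq bp (Y.symmetric bq bm q∼′m) q∼′j)) m≁′p))
      R′⇒R : ∀ {i} → i < M → R′ (pos m) (pos i) ≡ true → R (pos m) (pos i) ≡ true
      R′⇒R {i} i<M m∼′i with ℕP.<-cmp i p
      ... | tri< i<p _ _  = trans (agree m<p i<p bm (<⇒InRange i<M)) m∼′i
      ... | tri≈ _ refl _ = ⊥-elim (true≢false (trans (sym m∼′i) m≁′p))
      ... | tri> _ _ p<i  = ⊥-elim (true≢false (trans (sym m∼′i) (m≁′later p<i i<M)))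
      smaller : posCount R′ m < posCount R m
      smaller = countᵇ-< _ _ _ (applyUpTo⁺₁ pos M R′⇒R) (pos∈ bp) m≁′p
                  (X.symmetric bp bm (X.transitive bp bq bm p∼q q∼m))

  AgreeOnPositives : Set
  AgreeOnPositives = ∀ {k l} → InRange n k → InRange n l → R (pos k) (pos l) ≡ R′ (pos k) (pos l)

  module _ (agree : AgreeOnPositives) where

    LeastPos⇒LeastPos′ : ∀ {k} → InRange n k → LeastPos R k → LeastPos R′ k
    LeastPos⇒LeastPos′ bk = LeastPos-transfer R R′ λ l<k → agree bk (InRange-< l<k bk)

    LeastPos′⇒LeastPos : ∀ {k} → InRange n k → LeastPos R′ k → LeastPos R k
    LeastPos′⇒LeastPos bk = LeastPos-transfer R′ R λ l<k → sym (agree bk (InRange-< l<k bk))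

    nonswitching-agree : ∀ {k} → InRange n k → LeastPos R k → nonswitching R (pos k) ≡ nonswitching R′ (pos k)
    nonswitching-agree {k} bk lk = begin
      nonswitching R (pos k)                          ≡⟨ cong (_∧ nonswitching R (pos k)) (sym isLeast) ⟩
      leastOfNonswitching R (pos k)                   ≡⟨ leastOfNonswitching-agree bk ⟩
      leastOfNonswitching R′ (pos k)                  ≡⟨ cong (_∧ nonswitching R′ (pos k)) isLeast′ ⟩
      nonswitching R′ (pos k)                         ∎
      where
      open ≡-Reasoning
      isLeast = LeastPos⇒isLeastPos R bk lk
      isLeast′ = LeastPos⇒isLeastPos R′ bk (LeastPos⇒LeastPos′ bk lk)

    -- R′ would open fewer blocks meeting ±1: those of R′ before m clash with the
    -- off-unit block of m, and those after m must already meet ±1 in R.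
    unitBlock-half : ∀ {m} → InRange n m → leastOfUnitBlock R (pos m) ≡ true → leastOfUnitBlock R′ (pos m) ≡ false → ⊥
    unitBlock-half {m} bm unit unit′ = ℕP.<-irrefl (sym #unitBlocks-agree) fewer
      where
      lm = isLeastPos⇒LeastPos R bm (∧-trueˡ unit)
      lm′ = LeastPos⇒LeastPos′ bm lm
      m∼unit = ∧-trueʳ {isLeastPos n R (pos m)} unit
      m≁′unit = ∧-false (LeastPos⇒isLeastPos R′ bm lm′) unit′
      off′ : Y.SwitchingOffUnit m
      off′ = Y.switchingOffUnit bm lm′ (trans (sym (nonswitching-agree bm lm)) (X.unit⇒switching m∼unit))
                                  (∨-falseˡ m≁′unit) (∨-falseʳ m≁′unit)
      R′⇒R : ∀ {i} → i < M → leastOfUnitBlock R′ (pos i) ≡ true → leastOfUnitBlock R (pos i) ≡ true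
      R′⇒R {i} i<M unitᵢ′ with ℕP.<-cmp i m
      ... | tri< i<m _ _  =
        ⊥-elim (Y.offUnit⇒no-earlier-unit-block off′ i<m bi li′ (∨-true (∧-trueʳ {isLeastPos n R′ (pos i)} unitᵢ′)))
        where
        bi = <⇒InRange i<M
        li′ = isLeastPos⇒LeastPos R′ bi (∧-trueˡ unitᵢ′)
      ... | tri≈ _ refl _ = ⊥-elim (true≢false (trans (sym unitᵢ′) unit′))
      ... | tri> _ _ m<i  with meetsUnit R (pos i) in i∼unit
      ...   | true  = ∧-true (LeastPos⇒isLeastPos R bi li) refl
        where
        bi = <⇒InRange i<M
        li = LeastPos′⇒LeastPos bi (isLeastPos⇒LeastPos R′ bi (∧-trueˡ unitᵢ′))
      ...   | false = ⊥-elim (X.offUnit⇒no-earlier-unit-block offᵢ m<i bm lm (∨-true m∼unit))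
        where
        bi = <⇒InRange i<M
        li = LeastPos′⇒LeastPos bi (isLeastPos⇒LeastPos R′ bi (∧-trueˡ unitᵢ′))
        offᵢ = X.switchingOffUnit bi li
                 (trans (nonswitching-agree bi li) (Y.unit⇒switching (∧-trueʳ {isLeastPos n R′ (pos i)} unitᵢ′)))
                 (∨-falseˡ i∼unit) (∨-falseʳ i∼unit)
      fewer : countᵇ (leastOfUnitBlock R′) (applyUpTo pos M) < countᵇ (leastOfUnitBlock R) (applyUpTo pos M)
      fewer = countᵇ-< _ _ _ (applyUpTo⁺₁ pos M R′⇒R) (pos∈ bm) unit′ unit

    PartnerAgree : ℕ → Set
    PartnerAgree x = X.SwitchingOffUnit x → ∀ {v} → InRange n v → LeastPos R v → R (pos x) (neg v) ≡ R′ (pos x) (neg v)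

    -- The partner of m in R′ cannot lie beyond its partner u in R: its own R-partner w
    -- would come before m by antitonicity, yet be paired with it in R′.
    partner-≮ : (∀ {k} → X.SwitchingOffUnit k → Y.SwitchingOffUnit k) →
      (∀ {k} → Y.SwitchingOffUnit k → X.SwitchingOffUnit k) →
      ∀ {m u u′} → X.SwitchingOffUnit m → (∀ {x} → x < m → PartnerAgree x) →
      InRange n u → InRange n u′ → LeastPos R u → LeastPos R′ u′ →
      R (pos m) (neg u) ≡ true → R′ (pos m) (neg u′) ≡ true → u < u′ → ⊥
    partner-≮ toY toX {m} {u} {u′} om earlier bu bu′ lu lu′ m∼-u m∼′-u′ u<u′
      with X.partner (toX (Y.partner-offUnit (toY om) bu′ lu′ m∼′-u′))
    ... | w , bw , lw , u′∼-w = ℕP.<-irrefl w≡m w<m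
      where
      bm = X.SwitchingOffUnit.inRange om
      lm = X.SwitchingOffUnit.leastPos om
      ou′ = toX (Y.partner-offUnit (toY om) bu′ lu′ m∼′-u′)
      w<m : w < m
      w<m = X.partner-antitone (X.partner-offUnit om bu lu m∼-u) ou′ u<u′ bm bw lm lw (X.∼neg-flip bm bu m∼-u) u′∼-w
      w∼′-u′ : R′ (pos w) (neg u′) ≡ true
      w∼′-u′ = trans (sym (earlier w<m (X.partner-offUnit ou′ bw lw u′∼-w) bu′ (LeastPos′⇒LeastPos bu′ lu′)))
                     (X.∼neg-flip bu′ bw u′∼-w)
      w≡m : w ≡ m
      w≡m = Y.partner-injective bw bm bu′ (LeastPos⇒LeastPos′ bw lw) (LeastPos⇒LeastPos′ bm lm) w∼′-u′ m∼′-u′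

-- Reconstruction of a partition from its statistics

module Reconstruction (n : ℕ) (two : 2 ≤ n) (R R′ : ℤ → ℤ → Bool)
  (P : NonnestingPartition n R) (P′ : NonnestingPartition n R′)
  (a≡ : aStat n R ≡ aStat n R′) (μ≡ : μStat n R ≡ μStat n R′)
  (ν≡ : νStat n R ≡ νStat n R′) (c≡ : cStat n R ≡ cStat n R′) where

  open Positives n
  module X = Blocks n two R P
  module Y = Blocks n two R′ P′
  module C  = Compare n two R R′ P P′ a≡ μ≡ ν≡ c≡
  module C′ = Compare n two R′ R P′ P (sym a≡) (sym μ≡) (sym ν≡) (sym c≡)

  Agree : ℤ → ℤ → Set
  Agree s t = R s t ≡ R′ s t

  flipBelow : ∀ {p} → C.AgreeBelow p → C′.AgreeBelow p
  flipBelow agree k<p l<p bk bl = sym (agree k<p l<p bk bl)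

  agree-at : ∀ {p} → InRange n p → C.AgreeBelow p → ∀ {l} → l < p → Agree (pos p) (pos l)
  agree-at {p} bp below {l} l<p with nearestEarlier? R p | nearestEarlier? R′ p
  ... | inj₂ lp | inj₂ lp′ = trans (lp l<p) (sym (lp′ l<p))
  ... | inj₁ (q , q<p , p∼q , _) | inj₂ lp′ =
    ⊥-elim (true≢false (trans (sym p∼q) (C′.LeastPos-at (flipBelow below) bp lp′ q<p)))
  ... | inj₂ lp | inj₁ (q′ , q′<p , p∼′q′ , _) =
    ⊥-elim (true≢false (trans (sym p∼′q′) (C.LeastPos-at below bp lp q′<p)))
  ... | inj₁ (q , q→p@(q<p , p∼q , _)) | inj₁ (q′ , q′→p@(_ , p∼′q′ , _)) with ℕP.<-cmp q q′
  ...   | tri< q<q′ _ _ = ⊥-elim (C.nearestEarlier-≮ below bp q→p q′→p q<q′)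
  ...   | tri> _ _ q′<q = ⊥-elim (C′.nearestEarlier-≮ (flipBelow below) bp q′→p q→p q′<q)
  ...   | tri≈ _ refl _ = begin
    R (pos p) (pos l)  ≡⟨ X.∼-congˡ bp bq bl p∼q ⟩
    R (pos q) (pos l)  ≡⟨ below q<p l<p bq bl ⟩
    R′ (pos q) (pos l) ≡⟨ sym (Y.∼-congˡ bp bq bl p∼′q′) ⟩
    R′ (pos p) (pos l) ∎
    where
    open ≡-Reasoning
    bq = InRange-< q<p bp
    bl = InRange-< l<p bp

  agreeBelow : ∀ p → C.AgreeBelow p
  agreeBelow (suc p) {k} {l} (s≤s k≤p) (s≤s l≤p) bk bl with ℕP.m≤n⇒m<n∨m≡n k≤p | ℕP.m≤n⇒m<n∨m≡n l≤p
  ... | inj₁ k<p  | inj₁ l<p  = agreeBelow p k<p l<p bk bl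
  ... | inj₂ refl | inj₁ l<p  = agree-at bk (agreeBelow k) l<p
  ... | inj₁ k<p  | inj₂ refl = trans (X.∼-comm bk bl) (trans (agree-at bl (agreeBelow l) k<p) (Y.∼-comm bl bk))
  ... | inj₂ refl | inj₂ refl = trans (X.reflexive bk) (sym (Y.reflexive bk))

  agreeOnPositives : C.AgreeOnPositives
  agreeOnPositives {k} {l} = agreeBelow (suc (k + l)) (s≤s (ℕP.m≤m+n k l)) (s≤s (ℕP.m≤n+m l k))

  agreeOnPositives′ : C′.AgreeOnPositives
  agreeOnPositives′ bk bl = sym (agreeOnPositives bk bl)

  unitBlock-agree : ∀ {k} → InRange n k → leastOfUnitBlock R (pos k) ≡ leastOfUnitBlock R′ (pos k)
  unitBlock-agree {k} bk with leastOfUnitBlock R (pos k) in unit | leastOfUnitBlock R′ (pos k) in unit′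
  ... | true  | true  = refl
  ... | false | false = refl
  ... | true  | false = ⊥-elim (C.unitBlock-half agreeOnPositives bk unit unit′)
  ... | false | true  = ⊥-elim (C′.unitBlock-half agreeOnPositives′ bk unit′ unit)

  units-agree-at-least : ∀ {m} → InRange n m → LeastPos R m → units R (pos m) ≡ units R′ (pos m)
  units-agree-at-least {m} bm lm with leastOfUnitBlock R (pos m) in unit
  ... | true  = map-filterᵇ-≡-at (units R) (units R′) _ _ pos M
      (onPositives (map (units R) ∘ filterᵇ (leastOfUnitBlock R)) (map (units R′) ∘ filterᵇ (leastOfUnitBlock R′)) c≡)
      (InRange⇒< bm) (λ i<m → unitBlock-agree (InRange-< i<m bm)) unit (trans (sym (unitBlock-agree bm)) unit)
  ... | false = cong₂ _,_ (trans (∨-falseˡ off) (sym (∨-falseˡ off′))) (trans (∨-falseʳ off) (sym (∨-falseʳ off′)))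
    where
    off = ∧-false (LeastPos⇒isLeastPos R bm lm) unit
    off′ = ∧-false (LeastPos⇒isLeastPos R′ bm (C.LeastPos⇒LeastPos′ agreeOnPositives bm lm))
                   (trans (sym (unitBlock-agree bm)) unit)

  units-agree : ∀ {k} → InRange n k → units R (pos k) ≡ units R′ (pos k)
  units-agree {k} bk with X.leastOfBlock bk
  ... | m , m≤k , lm , k∼m = begin
    units R (pos k)  ≡⟨ cong₂ _,_ (X.∼-congˡ bk bm X.g₁ k∼m) (X.∼-congˡ bk bm X.g₋₁ k∼m) ⟩
    units R (pos m)  ≡⟨ units-agree-at-least bm lm ⟩
    units R′ (pos m) ≡⟨ sym (cong₂ _,_ (Y.∼-congˡ bk bm X.g₁ k∼′m) (Y.∼-congˡ bk bm X.g₋₁ k∼′m)) ⟩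
    units R′ (pos k) ∎
    where
    open ≡-Reasoning
    bm = InRange-≤ m≤k bk
    k∼′m = trans (sym (agreeOnPositives bk bm)) k∼m

  pos∼one-agree : ∀ {k} → InRange n k → Agree (pos k) (+ 1)
  pos∼one-agree bk = cong proj₁ (units-agree bk)

  pos∼minus-one-agree : ∀ {k} → InRange n k → Agree (pos k) -[1+ 0 ]
  pos∼minus-one-agree bk = cong proj₂ (units-agree bk)

  offUnit⇒offUnit′ : ∀ {k} → X.SwitchingOffUnit k → Y.SwitchingOffUnit k
  offUnit⇒offUnit′ (X.switchingOffUnit bk lk sw ≁one ≁minus-one) = Y.switchingOffUnit bk
    (C.LeastPos⇒LeastPos′ agreeOnPositives bk lk) (trans (sym (C.nonswitching-agree agreeOnPositives bk lk)) sw)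
    (trans (sym (pos∼one-agree bk)) ≁one) (trans (sym (pos∼minus-one-agree bk)) ≁minus-one)

  offUnit′⇒offUnit : ∀ {k} → Y.SwitchingOffUnit k → X.SwitchingOffUnit k
  offUnit′⇒offUnit (Y.switchingOffUnit bk lk sw ≁one ≁minus-one) = X.switchingOffUnit bk
    (C′.LeastPos⇒LeastPos′ agreeOnPositives′ bk lk) (trans (sym (C′.nonswitching-agree agreeOnPositives′ bk lk)) sw)
    (trans (pos∼one-agree bk) ≁one) (trans (pos∼minus-one-agree bk) ≁minus-one)

  partner-agree-step : ∀ {m} → (∀ {x} → x < m → C.PartnerAgree agreeOnPositives x) → C.PartnerAgree agreeOnPositives m
  partner-agree-step {m} earlier om {v} bv lv with X.partner om | Y.partner (offUnit⇒offUnit′ om)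
  ... | u , bu , lu , m∼-u | u′ , bu′ , lu′ , m∼′-u′ with ℕP.<-cmp u u′
  ...   | tri< u<u′ _ _ = ⊥-elim (C.partner-≮ agreeOnPositives offUnit⇒offUnit′ offUnit′⇒offUnit
                                    om earlier bu bu′ lu lu′ m∼-u m∼′-u′ u<u′)
  ...   | tri> _ _ u′<u = ⊥-elim (C′.partner-≮ agreeOnPositives′ offUnit′⇒offUnit offUnit⇒offUnit′
                                    (offUnit⇒offUnit′ om) earlier′ bu′ bu lu′ lu m∼′-u′ m∼-u u′<u)
    where
    earlier′ : ∀ {x} → x < m → C′.PartnerAgree agreeOnPositives′ x
    earlier′ x<m ox′ bw lw′ =
      sym (earlier x<m (offUnit′⇒offUnit ox′) bw (C′.LeastPos⇒LeastPos′ agreeOnPositives′ bw lw′))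
  ...   | tri≈ _ refl _ = ≡-from-≡true
    (λ m∼-v → subst (λ w → R′ (pos m) (neg w) ≡ true) (X.partner-unique bm bu bv lu lv m∼-u m∼-v) m∼′-u′)
    (λ m∼′-v → subst (λ w → R (pos m) (neg w) ≡ true)
                 (Y.partner-unique bm bu bv lu′ (C.LeastPos⇒LeastPos′ agreeOnPositives bv lv) m∼′-u′ m∼′-v) m∼-u)
    where
    bm = X.SwitchingOffUnit.inRange om

  partner-agree : ∀ p {x} → x < p → C.PartnerAgree agreeOnPositives x
  partner-agree (suc p) (s≤s x≤p) with ℕP.m≤n⇒m<n∨m≡n x≤p
  ... | inj₁ x<p  = partner-agree p x<p
  ... | inj₂ refl = partner-agree-step (partner-agree p)

  unitBlock-pos∼neg-agree : ∀ {k l} → InRange n k → InRange n l → meetsUnit R (pos k) ≡ true →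
    Agree (pos k) (neg l)
  unitBlock-pos∼neg-agree {k} {l} bk bl k∼unit = begin
    R (pos k) (neg l)                                                      ≡⟨ X.unit-block-pos∼neg bk bl k∼unit ⟩
    R (pos k) (+ 1) ∧ R (pos l) -[1+ 0 ] ∨ R (pos k) -[1+ 0 ] ∧ R (pos l) (+ 1)
      ≡⟨ cong₂ _∨_ (cong₂ _∧_ (pos∼one-agree bk) (pos∼minus-one-agree bl))
                   (cong₂ _∧_ (pos∼minus-one-agree bk) (pos∼one-agree bl)) ⟩
    R′ (pos k) (+ 1) ∧ R′ (pos l) -[1+ 0 ] ∨ R′ (pos k) -[1+ 0 ] ∧ R′ (pos l) (+ 1)
      ≡⟨ sym (Y.unit-block-pos∼neg bk bl k∼′unit) ⟩
    R′ (pos k) (neg l)                                                     ∎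
    where
    open ≡-Reasoning
    k∼′unit = trans (sym (cong₂ _∨_ (pos∼one-agree bk) (pos∼minus-one-agree bk))) k∼unit

  pos∼neg-agree : ∀ {k l} → InRange n k → InRange n l → Agree (pos k) (neg l)
  pos∼neg-agree {k} {l} bk bl with meetsUnit R (pos k) in k∼unit
  ... | true  = unitBlock-pos∼neg-agree bk bl k∼unit
  ... | false with X.leastOfBlock bk | X.leastOfBlock bl
  ...   | m , m≤k , lm , k∼m | v , v≤l , lv , l∼v = begin
    R (pos k) (neg l)  ≡⟨ trans (X.∼-congˡ bk bm bl k∼m) (X.∼-congʳ bm bl bv (X.neg-closed bl bv l∼v)) ⟩
    R (pos m) (neg v)  ≡⟨ at-leasts ⟩
    R′ (pos m) (neg v) ≡⟨ sym (trans (Y.∼-congˡ bk bm bl k∼′m) (Y.∼-congʳ bm bl bv (Y.neg-closed bl bv l∼′v))) ⟩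
    R′ (pos k) (neg l) ∎
    where
    open ≡-Reasoning
    bm = InRange-≤ m≤k bk
    bv = InRange-≤ v≤l bl
    k∼′m = trans (sym (agreeOnPositives bk bm)) k∼m
    l∼′v = trans (sym (agreeOnPositives bl bv)) l∼v
    m≁unit : meetsUnit R (pos m) ≡ false
    m≁unit = trans (sym (cong₂ _∨_ (X.∼-congˡ bk bm X.g₁ k∼m) (X.∼-congˡ bk bm X.g₋₁ k∼m))) k∼unit
    at-leasts : Agree (pos m) (neg v)
    at-leasts with nonswitching R (pos m) in ns
    ... | true  = trans (X.nonswitching⇒≁neg bm bv ns)
                        (sym (Y.nonswitching⇒≁neg bm bv (trans (sym (C.nonswitching-agree agreeOnPositives bm lm)) ns)))
    ... | false = partner-agree (suc m) (ℕP.n<1+n m)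
                    (X.switchingOffUnit bm lm ns (∨-falseˡ m≁unit) (∨-falseʳ m≁unit)) bv lv

  zero∼pos-agree : ∀ {k} → InRange n k → Agree (+ 0) (pos k)
  zero∼pos-agree bk = trans (X.zero∼≡∼neg bk) (trans (pos∼neg-agree bk bk) (sym (Y.zero∼≡∼neg bk)))

  zero∼one-agree : Agree (+ 0) (+ 1)
  zero∼one-agree = ≡-from-≡true to from
    where
    to : R (+ 0) (+ 1) ≡ true → R′ (+ 0) (+ 1) ≡ true
    to 0∼1 with X.zero∼one⇒units 0∼1
    ... | k , bk , k∼1 , k∼-1 =
      Y.units⇒zero∼one bk (trans (sym (pos∼one-agree bk)) k∼1) (trans (sym (pos∼minus-one-agree bk)) k∼-1)
    from : R′ (+ 0) (+ 1) ≡ true → R (+ 0) (+ 1) ≡ true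
    from 0∼′1 with Y.zero∼one⇒units 0∼′1
    ... | k , bk , k∼′1 , k∼′-1 =
      X.units⇒zero∼one bk (trans (pos∼one-agree bk) k∼′1) (trans (pos∼minus-one-agree bk) k∼′-1)

  agree-refl : ∀ {s} → InGround n s → Agree s s
  agree-refl gs = trans (X.reflexive gs) (sym (Y.reflexive gs))

  agree-comm : ∀ {s t} → InGround n s → InGround n t → Agree t s → Agree s t
  agree-comm gs gt e = trans (X.∼-comm gs gt) (trans e (Y.∼-comm gt gs))

  agree-neg : ∀ {s t} → InGround n s → InGround n t → Agree s (- t) → Agree (- s) t
  agree-neg {s} {t} gs gt e =
    subst (Agree (- s)) (neg-involutive t) (trans (X.∼-neg gs g-t) (trans e (sym (Y.∼-neg gs g-t))))
    where
    g-t = InGround-neg t gt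

  agree-zero : ∀ t → InGround n t → Agree (+ 0) t
  agree-zero (+ zero)        g₀ = agree-refl g₀
  agree-zero (+ suc zero)    _  = zero∼one-agree
  agree-zero (+ suc (suc k)) bk = zero∼pos-agree bk
  agree-zero -[1+ zero ]     _  = agree-neg X.g₀ X.g₋₁ zero∼one-agree
  agree-zero -[1+ suc k ]    bk = agree-neg X.g₀ bk (zero∼pos-agree bk)

  agree-one : ∀ t → InGround n t → Agree (+ 1) t
  agree-one (+ zero)        g₀ = agree-comm X.g₁ g₀ zero∼one-agree
  agree-one (+ suc zero)    g₁ = agree-refl g₁
  agree-one (+ suc (suc k)) bk = agree-comm X.g₁ bk (pos∼one-agree bk)
  agree-one -[1+ zero ]     _  = trans (sym (X.zero∼≡∼neg X.g₁)) (trans zero∼one-agree (Y.zero∼≡∼neg X.g₁))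
  agree-one -[1+ suc k ]    bk = agree-neg X.g₋₁ bk (agree-comm X.g₋₁ bk (pos∼minus-one-agree bk))

  agree-pos : ∀ {k} t → InRange n k → InGround n t → Agree (pos k) t
  agree-pos (+ zero)        bk g₀ = agree-comm bk g₀ (zero∼pos-agree bk)
  agree-pos (+ suc zero)    bk _  = pos∼one-agree bk
  agree-pos (+ suc (suc l)) bk bl = agreeOnPositives bk bl
  agree-pos -[1+ zero ]     bk _  = pos∼minus-one-agree bk
  agree-pos -[1+ suc l ]    bk bl = pos∼neg-agree bk bl

  agree : ∀ s t → InGround n s → InGround n t → Agree s t
  agree (+ zero)        t _  gt = agree-zero t gt
  agree (+ suc zero)    t _  gt = agree-one t gt
  agree (+ suc (suc k)) t bk gt = agree-pos t bk gt
  agree -[1+ zero ]     t _  gt = agree-neg X.g₁ gt (agree-one (- t) (InGround-neg t gt))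
  agree -[1+ suc k ]    t bk gt = agree-neg bk gt (agree-pos (- t) bk (InGround-neg t gt))

lemma2p10 : (n : ℕ) → 2 ≤ n →
    (hs hs′ : List (DHyperplane n)) (R R′ : ℤ → ℤ → Bool) →
    IsPart n hs R → IsPart n hs′ R′ →
    NonNesting n R → NonNesting n R′ →
    aStat n R ≡ aStat n R′ → μStat n R ≡ μStat n R′ →
    νStat n R ≡ νStat n R′ → cStat n R ≡ cStat n R′ →
    ∀ s t → InGround n s → InGround n t → R s t ≡ R′ s t
lemma2p10 n two hs hs′ R R′ part part′ nn nn′ a≡ μ≡ ν≡ c≡ =
  Reconstruction.agree n two R R′
    (isPart⇒nonnestingPartition part two nn) (isPart⇒nonnestingPartition part′ two nn′) a≡ μ≡ ν≡ c≡
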